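{- Let $m\ge1$ be an integer and $b$ a complex number. Let $f_m(z,0,b)=\sum_{n\ge0}c(n,m,0,b)z^n$ be the unique formal power series with $f_m=1+bz^mf_m^2$, and $d_0^{(m)}(N,0,b)=\det\big(c(i+j,m,0,b)\big)_{i,j=0}^{N-1}$. Then for all $n\ge0$ $$d_0^{(m)}(mn,0,b)=(-1)^{\binom{m-1}{2}n}b^{n(mn-1)},\qquad d_0^{(m)}(mn+1,0,b)=(-1)^{\binom{m-1}2n}b^{n(mn+1)},$$ and $d_0^{(m)}(N,0,b)=0$ for all $N\ge0$ not of the form $mn$ or $mn+1$.
   Context: The determinant of a $0\times0$ matrix is $1$. -}

module Defs where

open import Level using (Level)
open import Data.Nat using (ℕ; zero; suc; _≤?_; _∸_) renaming (_+_ to _+ℕ_)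
open import Data.Fin using (Fin; toℕ; punchIn) renaming (zero to fzero; suc to fsuc)
open import Relation.Nullary using (yes; no)
open import Algebra.Bundles using (CommutativeRing)

module _ {c ℓ : Level} (R : CommutativeRing c ℓ) where
  open CommutativeRing R

  pow : Carrier → ℕ → Carrier
  pow x zero    = 1#
  pow x (suc k) = x * pow x k

  sgn : ℕ → Carrier
  sgn k = pow (- 1#) k

  sumFin : (n : ℕ) → (Fin n → Carrier) → Carrier
  sumFin zero    f = 0#
  sumFin (suc n) f = f fzero + sumFin n (λ i → f (fsuc i))

  det : (n : ℕ) → (Fin n → Fin n → Carrier) → Carrier
  det zero    M = 1#
  det (suc n) M =
    sumFin (suc n) (λ j → sgn (toℕ j) * (M fzero j * det n (λ i k → M (fsuc i) (punchIn j k))))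

  PowerSeries : Set c
  PowerSeries = ℕ → Carrier

  oneS : PowerSeries
  oneS zero    = 1#
  oneS (suc _) = 0#

  mulS : PowerSeries → PowerSeries → PowerSeries
  mulS f g n = sumFin (suc n) (λ i → f (toℕ i) * g (n ∸ toℕ i))

  addS : PowerSeries → PowerSeries → PowerSeries
  addS f g n = f n + g n

  monoMulS : Carrier → ℕ → PowerSeries → PowerSeries
  monoMulS b m f n with m ≤? n
  ... | yes _ = b * f (n ∸ m)
  ... | no  _ = 0#

  IsFm : ℕ → Carrier → PowerSeries → Set ℓ
  IsFm m b f = ∀ n → f n ≈ addS oneS (monoMulS b m (mulS f f)) n

  hankelDet : PowerSeries → ℕ → Carrier
  hankelDet f N = det N (λ i j → f (toℕ i +ℕ toℕ j))

module Submission where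

-- Count walks on ℕ with steps ±1 that stay non-negative (as elements
-- of the ring R). Closed walks from 0 of length 2t are counted by the Catalan number
-- C_t, and by strong induction on the index the fixed-point equation forces
-- f(tm) = C_t b^t and f(n) = 0 for m ∤ n. Splitting the closed walks counted
-- by f(i+j) at an intermediate time factors the Hankel matrix H = (f(i+j))
-- as A·W, where W is upper triangular with powers of b on the diagonal and A
-- is block triangular with m×m blocks of the shape (b^q) ⊕ antidiagonal(b^q).
-- Hence det H_N = det A_N · Π W_jj, and the blocks give the sign
-- (-1)^(binomial (m-1) 2) and the power of b; a partial block of size
-- 2 ≤ e < m has a zero row, which gives the vanishing.

open import Level using (Level)
open import Algebra.Bundles using (CommutativeRing)
open import Defs

module _ {c ℓ : Level} (R : CommutativeRing c ℓ) where

  open import Data.Nat using (ℕ; zero; suc; pred; _∸_; _<_; _≤_; z≤n; s≤s; _≟_; _<?_; _≤?_; _%_; _/_)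
    renaming (_+_ to _+ₙ_; _*_ to _*ₙ_)
  import Data.Nat.Properties as N
  open import Data.Nat.Combinatorics using (_C_; nCk+nC[k+1]≡[n+1]C[k+1]; nC1≡n)
  open import Data.Nat.DivMod using (m≡m%n+[m/n]*n; m%n<n; [m+kn]%n≡m%n; m<n⇒m%n≡m; m/n≤m; /-monoˡ-≤; m*n/n≡m)
  open import Data.Nat.Tactic.RingSolver using (solve-∀)
  open import Data.Nat.Induction using (<-rec)
  open import Data.Fin using (Fin; toℕ; punchIn) renaming (zero to fzero; suc to fsuc)
  open import Data.Fin.Properties using (toℕ<n)
  open import Data.Product using (Σ; _,_; _×_; proj₁; proj₂)
  open import Data.Empty using (⊥-elim)
  open import Relation.Binary.PropositionalEquality as P using (_≡_; _≢_)
  open import Relation.Binary.Definitions using (tri<; tri≈; tri>)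
  open import Relation.Nullary using (Dec; yes; no; ¬_)

  open CommutativeRing R hiding (zero)
  open import Algebra.Properties.Ring ring using (-1*x≈-x)
  open import Algebra.Solver.Ring.NaturalCoefficients.Default commutativeSemiring
  open import Relation.Binary.Reasoning.Setoid setoid

  -- Σ_{k<n} g k; every sum in the proof is indexed by ℕ rather than Fin.
  sumTo : ℕ → (ℕ → Carrier) → Carrier
  sumTo zero    g = 0#
  sumTo (suc n) g = g 0 + sumTo n (λ k → g (suc k))

  prodTo : ℕ → (ℕ → Carrier) → Carrier
  prodTo zero    g = 1#
  prodTo (suc n) g = g 0 * prodTo n (λ k → g (suc k))

  sumFin≈sumTo : ∀ n (g : ℕ → Carrier) → sumFin R n (λ i → g (toℕ i)) ≈ sumTo n g
  sumFin≈sumTo zero    g = refl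
  sumFin≈sumTo (suc n) g = +-cong refl (sumFin≈sumTo n (λ k → g (suc k)))

  sumFin-cong : ∀ n {f g : Fin n → Carrier} → (∀ i → f i ≈ g i) → sumFin R n f ≈ sumFin R n g
  sumFin-cong zero    e = refl
  sumFin-cong (suc n) e = +-cong (e fzero) (sumFin-cong n (λ i → e (fsuc i)))

  sumTo-cong : ∀ n {f g : ℕ → Carrier} → (∀ k → k < n → f k ≈ g k) → sumTo n f ≈ sumTo n g
  sumTo-cong zero    e = refl
  sumTo-cong (suc n) e = +-cong (e 0 (s≤s z≤n)) (sumTo-cong n (λ k k<n → e (suc k) (s≤s k<n)))

  sumTo-zero : ∀ n {f : ℕ → Carrier} → (∀ k → k < n → f k ≈ 0#) → sumTo n f ≈ 0#
  sumTo-zero zero    e = refl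
  sumTo-zero (suc n) e =
    trans (+-cong (e 0 (s≤s z≤n)) (sumTo-zero n (λ k k<n → e (suc k) (s≤s k<n)))) (+-identityˡ 0#)

  sumTo-+ : ∀ n (f g : ℕ → Carrier) → sumTo n (λ k → f k + g k) ≈ sumTo n f + sumTo n g
  sumTo-+ zero    f g = sym (+-identityˡ 0#)
  sumTo-+ (suc n) f g = trans (+-cong refl (sumTo-+ n _ _)) (interchange (f 0) (g 0) _ _)
    where
    interchange : ∀ a b x y → (a + b) + (x + y) ≈ (a + x) + (b + y)
    interchange = solve 4 (λ a b x y → (a :+ b) :+ (x :+ y) := (a :+ x) :+ (b :+ y)) refl

  sumTo-*ˡ : ∀ n x (f : ℕ → Carrier) → x * sumTo n f ≈ sumTo n (λ k → x * f k)
  sumTo-*ˡ zero    x f = zeroʳ x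
  sumTo-*ˡ (suc n) x f = trans (distribˡ x (f 0) _) (+-cong refl (sumTo-*ˡ n x _))

  sumTo-*ʳ : ∀ n x (f : ℕ → Carrier) → sumTo n f * x ≈ sumTo n (λ k → f k * x)
  sumTo-*ʳ n x f = trans (*-comm _ _) (trans (sumTo-*ˡ n x f) (sumTo-cong n (λ k _ → *-comm _ _)))

  sumTo-split : ∀ a b (g : ℕ → Carrier) → sumTo (a +ₙ b) g ≈ sumTo a g + sumTo b (λ k → g (a +ₙ k))
  sumTo-split zero    b g = sym (+-identityˡ _)
  sumTo-split (suc a) b g =
    trans (+-cong refl (sumTo-split a b (λ k → g (suc k)))) (sym (+-assoc _ _ _))

  sumTo-last : ∀ n (g : ℕ → Carrier) → sumTo (suc n) g ≈ sumTo n g + g n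
  sumTo-last n g = trans (reflexive (P.cong (λ z → sumTo z g) (N.+-comm 1 n)))
    (trans (sumTo-split n 1 g) (+-cong refl (trans (+-identityʳ _) (reflexive (P.cong g (N.+-identityʳ n))))))

  sumTo-extend : ∀ N M (g : ℕ → Carrier) → N ≤ M → (∀ s → N ≤ s → s < M → g s ≈ 0#) →
                 sumTo N g ≈ sumTo M g
  sumTo-extend N M g N≤M e = sym (trans (reflexive (P.cong (λ z → sumTo z g) (P.sym (N.m+[n∸m]≡n N≤M))))
    (trans (sumTo-split N (M ∸ N) g)
      (trans (+-cong refl (sumTo-zero (M ∸ N) (λ k k<d → e (N +ₙ k) (N.m≤m+n N k)
         (P.subst (λ z → N +ₙ k < z) (N.m+[n∸m]≡n N≤M) (N.+-monoʳ-< N k<d)))))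
      (+-identityʳ _))))

  sumTo-single : ∀ n a (g : ℕ → Carrier) → a < n → (∀ k → k < n → k ≢ a → g k ≈ 0#) → sumTo n g ≈ g a
  sumTo-single (suc n) zero g _ e =
    trans (+-cong refl (sumTo-zero n (λ k k<n → e (suc k) (s≤s k<n) (λ ())))) (+-identityʳ _)
  sumTo-single (suc n) (suc a) g (s≤s a<n) e =
    trans (+-cong (e 0 (s≤s z≤n) (λ ()))
                  (sumTo-single n a (λ k → g (suc k)) a<n
                     (λ k k<n k≢a → e (suc k) (s≤s k<n) (λ q → k≢a (N.suc-injective q)))))
          (+-identityˡ _)

  sumTo-blocks : ∀ μ K (g : ℕ → Carrier) →
                 sumTo (K *ₙ μ) g ≈ sumTo K (λ q → sumTo μ (λ r → g (q *ₙ μ +ₙ r)))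
  sumTo-blocks μ zero    g = refl
  sumTo-blocks μ (suc K) g = trans (sumTo-split μ (K *ₙ μ) g)
    (+-cong refl (trans (sumTo-blocks μ K (λ k → g (μ +ₙ k)))
       (sumTo-cong K (λ q _ → sumTo-cong μ (λ r _ → reflexive (P.cong g (P.sym (N.+-assoc μ (q *ₙ μ) r))))))))

  sumTo-multiples : ∀ μ K (g : ℕ → Carrier) → 0 < μ →
                    (∀ q r → 0 < r → r < μ → q < K → g (q *ₙ μ +ₙ r) ≈ 0#) →
                    sumTo (K *ₙ μ) g ≈ sumTo K (λ q → g (q *ₙ μ))
  sumTo-multiples μ K g 0<μ e = trans (sumTo-blocks μ K g) (sumTo-cong K (λ q q<K →
    trans (sumTo-single μ 0 (λ r → g (q *ₙ μ +ₙ r)) 0<μ (λ r r<μ r≢0 → e q r (N.n≢0⇒n>0 r≢0) r<μ q<K))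
          (reflexive (P.cong g (N.+-identityʳ (q *ₙ μ))))))

  sumTo-pair : ∀ n a b (g : ℕ → Carrier) → a < n → b < n → a ≢ b →
               (∀ k → k < n → k ≢ a → k ≢ b → g k ≈ 0#) → sumTo n g ≈ g a + g b
  sumTo-pair (suc n) zero zero g _ _ a≢b _ = ⊥-elim (a≢b P.refl)
  sumTo-pair (suc n) zero (suc b) g _ (s≤s b<n) _ e =
    +-cong refl (sumTo-single n b (λ k → g (suc k)) b<n
                   (λ k k<n k≢b → e (suc k) (s≤s k<n) (λ ()) (λ q → k≢b (N.suc-injective q))))
  sumTo-pair (suc n) (suc a) zero g (s≤s a<n) _ _ e =
    trans (+-comm _ _) (+-cong (sumTo-single n a (λ k → g (suc k)) a<n
                   (λ k k<n k≢a → e (suc k) (s≤s k<n) (λ q → k≢a (N.suc-injective q)) (λ ()))) refl)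
  sumTo-pair (suc n) (suc a) (suc b) g (s≤s a<n) (s≤s b<n) a≢b e =
    trans (+-cong (e 0 (s≤s z≤n) (λ ()) (λ ())) (sumTo-pair n a b (λ k → g (suc k)) a<n b<n
             (λ q → a≢b (P.cong suc q))
             (λ k k<n k≢a k≢b → e (suc k) (s≤s k<n) (λ q → k≢a (N.suc-injective q)) (λ q → k≢b (N.suc-injective q)))))
          (+-identityˡ _)

  prodTo-cong : ∀ n {f g : ℕ → Carrier} → (∀ k → k < n → f k ≈ g k) → prodTo n f ≈ prodTo n g
  prodTo-cong zero    e = refl
  prodTo-cong (suc n) e = *-cong (e 0 (s≤s z≤n)) (prodTo-cong n (λ k k<n → e (suc k) (s≤s k<n)))

  prodTo-* : ∀ n (f g : ℕ → Carrier) → prodTo n (λ k → f k * g k) ≈ prodTo n f * prodTo n g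
  prodTo-* zero    f g = sym (*-identityˡ 1#)
  prodTo-* (suc n) f g = trans (*-cong refl (prodTo-* n _ _)) (interchange (f 0) (g 0) _ _)
    where
    interchange : ∀ a b x y → (a * b) * (x * y) ≈ (a * x) * (b * y)
    interchange = solve 4 (λ a b x y → (a :* b) :* (x :* y) := (a :* x) :* (b :* y)) refl

  prodTo-split : ∀ a b (g : ℕ → Carrier) → prodTo (a +ₙ b) g ≈ prodTo a g * prodTo b (λ k → g (a +ₙ k))
  prodTo-split zero    b g = sym (*-identityˡ _)
  prodTo-split (suc a) b g =
    trans (*-cong refl (prodTo-split a b (λ k → g (suc k)))) (sym (*-assoc _ _ _))

  prodTo-last : ∀ n (g : ℕ → Carrier) → prodTo (suc n) g ≈ prodTo n g * g n
  prodTo-last n g = trans (reflexive (P.cong (λ z → prodTo z g) (N.+-comm 1 n)))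
    (trans (prodTo-split n 1 g) (*-cong refl (trans (*-identityʳ _) (reflexive (P.cong g (N.+-identityʳ n))))))

  prodTo-blocks : ∀ μ K (g : ℕ → Carrier) →
                  prodTo (K *ₙ μ) g ≈ prodTo K (λ q → prodTo μ (λ r → g (q *ₙ μ +ₙ r)))
  prodTo-blocks μ zero    g = refl
  prodTo-blocks μ (suc K) g = trans (prodTo-split μ (K *ₙ μ) g)
    (*-cong refl (trans (prodTo-blocks μ K (λ k → g (μ +ₙ k)))
       (prodTo-cong K (λ q _ → prodTo-cong μ (λ r _ → reflexive (P.cong g (P.sym (N.+-assoc μ (q *ₙ μ) r))))))))

  pow-+ : ∀ x a b → pow R x (a +ₙ b) ≈ pow R x a * pow R x b
  pow-+ x zero    b = sym (*-identityˡ _)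
  pow-+ x (suc a) b = trans (*-cong refl (pow-+ x a b)) (sym (*-assoc _ _ _))

  pow-* : ∀ x a b → pow R x (a *ₙ b) ≈ pow R (pow R x a) b
  pow-* x a zero    = reflexive (P.cong (pow R x) (N.*-zeroʳ a))
  pow-* x a (suc b) = trans (reflexive (P.cong (pow R x) (N.*-suc a b)))
    (trans (pow-+ x a (a *ₙ b)) (*-cong refl (pow-* x a b)))

  prodTo-const : ∀ n x → prodTo n (λ _ → x) ≈ pow R x n
  prodTo-const zero    x = refl
  prodTo-const (suc n) x = *-cong refl (prodTo-const n x)

  sgn-+ : ∀ a b → sgn R (a +ₙ b) ≈ sgn R a * sgn R b
  sgn-+ = pow-+ (- 1#)

  -- Determinants of ℕ-indexed matrices.
  Matrix : Set c
  Matrix = ℕ → ℕ → Carrier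

  detℕ : ℕ → Matrix → Carrier
  detℕ n F = det R n (λ i k → F (toℕ i) (toℕ k))

  -- punchIn on ℕ: the column of the full matrix that column k of the minor
  -- obtained by deleting column p comes from; punchOutℕ is its inverse.
  punchInℕ : ℕ → ℕ → ℕ
  punchInℕ zero    k       = suc k
  punchInℕ (suc p) zero    = zero
  punchInℕ (suc p) (suc k) = suc (punchInℕ p k)

  punchOutℕ : ℕ → ℕ → ℕ
  punchOutℕ zero    a       = pred a
  punchOutℕ (suc p) zero    = zero
  punchOutℕ (suc p) (suc a) = suc (punchOutℕ p a)

  toℕ-punchIn : ∀ {n} (j : Fin (suc n)) (k : Fin n) → toℕ (punchIn j k) ≡ punchInℕ (toℕ j) (toℕ k)
  toℕ-punchIn fzero    k        = P.refl
  toℕ-punchIn (fsuc j) fzero    = P.refl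
  toℕ-punchIn (fsuc j) (fsuc k) = P.cong suc (toℕ-punchIn j k)

  punchInℕ-< : ∀ p k → k < p → punchInℕ p k ≡ k
  punchInℕ-< (suc p) zero    _         = P.refl
  punchInℕ-< (suc p) (suc k) (s≤s k<p) = P.cong suc (punchInℕ-< p k k<p)

  punchInℕ-≥ : ∀ p k → p ≤ k → punchInℕ p k ≡ suc k
  punchInℕ-≥ zero    k       _         = P.refl
  punchInℕ-≥ (suc p) (suc k) (s≤s p≤k) = P.cong suc (punchInℕ-≥ p k p≤k)

  punchInℕ-≢ : ∀ p k → punchInℕ p k ≢ p
  punchInℕ-≢ zero    k       ()
  punchInℕ-≢ (suc p) zero    ()
  punchInℕ-≢ (suc p) (suc k) q = punchInℕ-≢ p k (N.suc-injective q)

  punchInℕ-punchOutℕ : ∀ p a → a ≢ p → punchInℕ p (punchOutℕ p a) ≡ a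
  punchInℕ-punchOutℕ zero    zero    a≢p = ⊥-elim (a≢p P.refl)
  punchInℕ-punchOutℕ zero    (suc a) a≢p = P.refl
  punchInℕ-punchOutℕ (suc p) zero    a≢p = P.refl
  punchInℕ-punchOutℕ (suc p) (suc a) a≢p = P.cong suc (punchInℕ-punchOutℕ p a (λ q → a≢p (P.cong suc q)))

  punchOutℕ-punchInℕ : ∀ p k → punchOutℕ p (punchInℕ p k) ≡ k
  punchOutℕ-punchInℕ zero    k       = P.refl
  punchOutℕ-punchInℕ (suc p) zero    = P.refl
  punchOutℕ-punchInℕ (suc p) (suc k) = P.cong suc (punchOutℕ-punchInℕ p k)

  punchOutℕ-< : ∀ n p a → a < suc n → p < suc n → a ≢ p → punchOutℕ p a < n
  punchOutℕ-< n       zero    zero    _         _         a≢p = ⊥-elim (a≢p P.refl)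
  punchOutℕ-< n       zero    (suc a) (s≤s a<n) _         _   = a<n
  punchOutℕ-< zero    (suc p) _       _         (s≤s ())  _
  punchOutℕ-< (suc n) (suc p) zero    _         _         _   = s≤s z≤n
  punchOutℕ-< (suc n) (suc p) (suc a) (s≤s a<n) (s≤s p<n) a≢p =
    s≤s (punchOutℕ-< n p a a<n p<n (λ q → a≢p (P.cong suc q)))

  punchOutℕ-> : ∀ p a → p < a → suc (punchOutℕ p a) ≡ a
  punchOutℕ-> zero    (suc a) _         = P.refl
  punchOutℕ-> (suc p) (suc a) (s≤s p<a) = P.cong suc (punchOutℕ-> p a p<a)

  punchInℕ-below : ∀ p k x → punchInℕ p k ≡ x → x < p → k ≡ x
  punchInℕ-below p k x q x<p with N.<-cmp k p
  ... | tri< k<p _ _ = P.trans (P.sym (punchInℕ-< p k k<p)) q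
  ... | tri≈ _ P.refl _ = ⊥-elim (N.<-asym x<p (P.subst (p <_) (P.trans (P.sym (punchInℕ-≥ p p N.≤-refl)) q) (N.n<1+n p)))
  ... | tri> _ _ p<k = ⊥-elim (N.<-asym x<p (P.subst (p <_) (P.trans (P.sym (punchInℕ-≥ p k (N.<⇒≤ p<k))) q) (N.m<n⇒m<1+n p<k)))

  punchInℕ-bound : ∀ p k n → p < suc n → k < n → punchInℕ p k < suc n
  punchInℕ-bound p k n p<n k<n with N.<-cmp k p
  ... | tri< k<p _ _ = P.subst (_< suc n) (P.sym (punchInℕ-< p k k<p)) (N.m<n⇒m<1+n k<n)
  ... | tri≈ _ k≡p _ = P.subst (_< suc n) (P.sym (punchInℕ-≥ p k (N.≤-reflexive (P.sym k≡p)))) (s≤s k<n)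
  ... | tri> _ _ p<k = P.subst (_< suc n) (P.sym (punchInℕ-≥ p k (N.<⇒≤ p<k))) (s≤s k<n)

  minor : ℕ → Matrix → Matrix
  minor p F i k = F (suc i) (punchInℕ p k)

  det-cong : ∀ n {M M' : Fin n → Fin n → Carrier} → (∀ i j → M i j ≈ M' i j) → det R n M ≈ det R n M'
  det-cong zero    e = refl
  det-cong (suc n) {M} {M'} e = sumFin-cong (suc n)
    {λ j → sgn R (toℕ j) * (M fzero j * det R n (λ i k → M (fsuc i) (punchIn j k)))}
    {λ j → sgn R (toℕ j) * (M' fzero j * det R n (λ i k → M' (fsuc i) (punchIn j k)))} (λ j → *-cong refl
    (*-cong (e fzero j) (det-cong n (λ i k → e (fsuc i) (punchIn j k)))))

  detℕ-cong : ∀ n {F G : Matrix} → (∀ i k → i < n → k < n → F i k ≈ G i k) → detℕ n F ≈ detℕ n G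
  detℕ-cong n e = det-cong n (λ i k → e (toℕ i) (toℕ k) (toℕ<n i) (toℕ<n k))

  laplace : ∀ n F → detℕ (suc n) F ≈ sumTo (suc n) (λ p → sgn R p * (F 0 p * detℕ n (minor p F)))
  laplace n F = trans
    (sumFin-cong (suc n)
      {λ j → sgn R (toℕ j) * (F 0 (toℕ j) * det R n (λ i k → F (suc (toℕ i)) (toℕ (punchIn j k))))}
      {λ j → sgn R (toℕ j) * (F 0 (toℕ j) * detℕ n (minor (toℕ j) F))} (λ j → *-cong refl (*-cong refl
      (det-cong n (λ i k → reflexive (P.cong (F (suc (toℕ i))) (toℕ-punchIn j k)))))))
    (sumFin≈sumTo (suc n) (λ p → sgn R p * (F 0 p * detℕ n (minor p F))))

  AgreeOff : ℕ → Matrix → Matrix → Set ℓ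
  AgreeOff a F G = ∀ i j → j ≢ a → F i j ≈ G i j

  det-linear : ∀ n a (F G H : Matrix) x y → a < n →
    (∀ i → F i a ≈ x * G i a + y * H i a) → AgreeOff a F G → AgreeOff a F H →
    detℕ n F ≈ x * detℕ n G + y * detℕ n H
  det-linear (suc n) a F G H x y a<n col eG eH =
    trans (laplace n F) (trans (sumTo-cong (suc n) term) (trans (sumTo-+ (suc n) (λ p → x * TG p) (λ p → y * TH p))
      (sym (+-cong (trans (*-cong refl (laplace n G)) (sumTo-*ˡ (suc n) x TG))
                   (trans (*-cong refl (laplace n H)) (sumTo-*ˡ (suc n) y TH))))))
    where
    TG TH : ℕ → Carrier
    TG p = sgn R p * (G 0 p * detℕ n (minor p G))
    TH p = sgn R p * (H 0 p * detℕ n (minor p H))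
    linear-entry : ∀ s g h d → s * ((x * g + y * h) * d) ≈ x * (s * (g * d)) + y * (s * (h * d))
    linear-entry = solve 6 (λ x y s g h d → s :* ((x :* g :+ y :* h) :* d)
                                        := x :* (s :* (g :* d)) :+ y :* (s :* (h :* d))) refl x y
    linear-minor : ∀ s e dg dh → s * (e * (x * dg + y * dh)) ≈ x * (s * (e * dg)) + y * (s * (e * dh))
    linear-minor = solve 6 (λ x y s e dg dh → s :* (e :* (x :* dg :+ y :* dh))
                                          := x :* (s :* (e :* dg)) :+ y :* (s :* (e :* dh))) refl x y
    -- Deleting column a leaves equal minors; deleting another column p
    -- leaves minors that are again linear in the column coming from a.
    term : ∀ p → p < suc n → sgn R p * (F 0 p * detℕ n (minor p F)) ≈ x * TG p + y * TH p
    term p p<n with p ≟ a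
    ... | yes P.refl = trans (*-cong refl (*-cong (col 0) (detℕ-cong n (λ i k _ _ → eG (suc i) (punchInℕ p k) (punchInℕ-≢ p k)))))
           (trans (linear-entry (sgn R p) (G 0 p) (H 0 p) (detℕ n (minor p G)))
             (+-cong refl (*-cong refl (*-cong refl (*-cong refl
               (detℕ-cong n (λ i k _ _ → trans (sym (eG (suc i) (punchInℕ p k) (punchInℕ-≢ p k)))
                                                (eH (suc i) (punchInℕ p k) (punchInℕ-≢ p k)))))))))
    ... | no p≢a = trans (*-cong refl (*-cong refl minor-linear))
           (trans (linear-minor (sgn R p) (F 0 p) _ _)
             (+-cong (*-cong refl (*-cong refl (*-cong (eG 0 p p≢a) refl)))
                     (*-cong refl (*-cong refl (*-cong (eH 0 p p≢a) refl)))))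
      where
      a≢p : a ≢ p
      a≢p q = p≢a (P.sym q)
      a' : ℕ
      a' = punchOutℕ p a
      a'-source : punchInℕ p a' ≡ a
      a'-source = punchInℕ-punchOutℕ p a a≢p
      off : ∀ {M} → AgreeOff a F M → AgreeOff a' (minor p F) (minor p M)
      off e i j j≢a' = e (suc i) (punchInℕ p j)
        (λ q → j≢a' (P.trans (P.sym (punchOutℕ-punchInℕ p j)) (P.cong (punchOutℕ p) q)))
      minor-linear : detℕ n (minor p F) ≈ x * detℕ n (minor p G) + y * detℕ n (minor p H)
      minor-linear = det-linear n a' (minor p F) (minor p G) (minor p H) x y (punchOutℕ-< n p a a<n p<n a≢p)
        (λ i → P.subst (λ z → F (suc i) z ≈ x * G (suc i) z + y * H (suc i) z) (P.sym a'-source) (col (suc i)))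
        (off eG) (off eH)

  det-additive : ∀ n a (F G H : Matrix) → a < n →
    (∀ i → F i a ≈ G i a + H i a) → AgreeOff a F G → AgreeOff a F H → detℕ n F ≈ detℕ n G + detℕ n H
  det-additive n a F G H a<n col eG eH =
    trans (det-linear n a F G H 1# 1# a<n (λ i → trans (col i) (sym (+-cong (*-identityˡ _) (*-identityˡ _)))) eG eH)
          (+-cong (*-identityˡ _) (*-identityˡ _))

  det-zero-column : ∀ n a F → a < n → (∀ i → F i a ≈ 0#) → detℕ n F ≈ 0#
  det-zero-column n a F a<n e =
    trans (det-linear n a F F F 0# 0# a<n
            (λ i → trans (e i) (sym (trans (+-cong (zeroˡ _) (zeroˡ _)) (+-identityˡ 0#))))
            (λ _ _ _ → refl) (λ _ _ _ → refl))
          (trans (+-cong (zeroˡ _) (zeroˡ _)) (+-identityˡ 0#))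

  AdjacentEqual : ℕ → Matrix → Set ℓ
  AdjacentEqual a F = ∀ i → F i a ≈ F i (suc a)

  punchInℕ-adjacent : ∀ a k → k ≢ a → punchInℕ a k ≡ punchInℕ (suc a) k
  punchInℕ-adjacent a k k≢a with N.<-cmp k a
  ... | tri< k<a _ _ = P.trans (punchInℕ-< a k k<a) (P.sym (punchInℕ-< (suc a) k (N.m<n⇒m<1+n k<a)))
  ... | tri≈ _ k≡a _ = ⊥-elim (k≢a k≡a)
  ... | tri> _ _ a<k = P.trans (punchInℕ-≥ a k (N.<⇒≤ a<k)) (P.sym (punchInℕ-≥ (suc a) k a<k))

  minor-adjacent : ∀ a F → AdjacentEqual a F → ∀ i k → minor (suc a) F i k ≈ minor a F i k
  minor-adjacent a F e i k with k ≟ a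
  ... | yes P.refl = P.subst₂ (λ z w → F (suc i) z ≈ F (suc i) w)
                       (P.sym (punchInℕ-< (suc k) k (N.n<1+n k))) (P.sym (punchInℕ-≥ k k N.≤-refl)) (e (suc i))
  ... | no k≢a = reflexive (P.cong (F (suc i)) (P.sym (punchInℕ-adjacent a k k≢a)))

  det-adjacent-equal : ∀ n a F → suc a < n → AdjacentEqual a F → detℕ n F ≈ 0#
  det-adjacent-equal (suc n) a F (s≤s sa≤n) e = begin
    detℕ (suc n) F     ≈⟨ laplace n F ⟩
    sumTo (suc n) T    ≈⟨ sumTo-pair (suc n) a (suc a) T (N.<-trans (N.n<1+n a) (s≤s sa≤n)) (s≤s sa≤n)
                            (λ q → N.1+n≢n (P.sym q)) others ⟩
    T a + T (suc a)    ≈⟨ +-cong refl (*-cong refl (*-cong (sym (e 0)) (detℕ-cong n (λ i k _ _ → minor-adjacent a F e i k)))) ⟩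
    T a + (- 1# * sgn R a) * (F 0 a * detℕ n (minor a F))
                       ≈⟨ +-cong refl (trans (*-assoc _ _ _) (-1*x≈-x _)) ⟩
    T a + - T a        ≈⟨ -‿inverseʳ (T a) ⟩
    0#                 ∎
    where
    T : ℕ → Carrier
    T p = sgn R p * (F 0 p * detℕ n (minor p F))
    vanishing-minor : ∀ p → detℕ n (minor p F) ≈ 0# → T p ≈ 0#
    vanishing-minor p d0 = trans (*-cong refl (trans (*-cong refl d0) (zeroʳ _))) (zeroʳ _)
    -- Any other deleted column leaves the two equal columns adjacent in the minor.
    others : ∀ p → p < suc n → p ≢ a → p ≢ suc a → T p ≈ 0#
    others p p<sn p≢a p≢sa with N.<-cmp p a
    ... | tri≈ _ q _ = ⊥-elim (p≢a q)
    ... | tri< p<a _ _ = vanishing-minor p (det-adjacent-equal n a' (minor p F)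
            (P.subst (λ z → suc z ≤ n) (P.sym a'+1) sa≤n) adjacent)
      where
      a' : ℕ
      a' = punchOutℕ p a
      a'+1 : suc a' ≡ a
      a'+1 = punchOutℕ-> p a p<a
      adjacent : AdjacentEqual a' (minor p F)
      adjacent i = P.subst₂ (λ z w → F (suc i) z ≈ F (suc i) w)
        (P.sym (punchInℕ-punchOutℕ p a (λ q → p≢a (P.sym q))))
        (P.sym (P.trans (P.cong (punchInℕ p) a'+1) (punchInℕ-≥ p a (N.<⇒≤ p<a)))) (e (suc i))
    ... | tri> _ _ a<p = vanishing-minor p (det-adjacent-equal n a (minor p F) (N.≤-trans sa<p (N.≤-pred p<sn)) adjacent)
      where
      sa<p : suc a < p
      sa<p = N.≤∧≢⇒< a<p (λ q → p≢sa (P.sym q))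
      adjacent : AdjacentEqual a (minor p F)
      adjacent i = P.subst₂ (λ z w → F (suc i) z ≈ F (suc i) w)
        (P.sym (punchInℕ-< p a a<p)) (P.sym (punchInℕ-< p (suc a) sa<p)) (e (suc i))

  setColumn : Matrix → ℕ → (ℕ → Carrier) → Matrix
  setColumn F a v i j with j ≟ a
  ... | yes _ = v i
  ... | no  _ = F i j

  setColumn-at : ∀ F a v i → setColumn F a v i a ≈ v i
  setColumn-at F a v i with a ≟ a
  ... | yes _ = refl
  ... | no q  = ⊥-elim (q P.refl)

  setColumn-off : ∀ F a v → AgreeOff a (setColumn F a v) F
  setColumn-off F a v i j j≢a with j ≟ a
  ... | yes q = ⊥-elim (j≢a q)
  ... | no _  = refl

  setColumn-agreeOff : ∀ F a u v → AgreeOff a (setColumn F a u) (setColumn F a v)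
  setColumn-agreeOff F a u v i j j≢a = trans (setColumn-off F a u i j j≢a) (sym (setColumn-off F a v i j j≢a))

  setColumn-preserves : ∀ {F G} a b v → AgreeOff a F G → AgreeOff a (setColumn F b v) (setColumn G b v)
  setColumn-preserves a b v e i j j≢a with j ≟ b
  ... | yes _ = refl
  ... | no _  = e i j j≢a

  setAdjacent : Matrix → ℕ → (ℕ → Carrier) → (ℕ → Carrier) → Matrix
  setAdjacent F a u v = setColumn (setColumn F a u) (suc a) v

  setAdjacent-a : ∀ F a u v i → setAdjacent F a u v i a ≈ u i
  setAdjacent-a F a u v i = trans (setColumn-off _ (suc a) v i a (λ q → N.1+n≢n (P.sym q))) (setColumn-at F a u i)

  setAdjacent-off : ∀ F a u v i j → j ≢ a → j ≢ suc a → setAdjacent F a u v i j ≈ F i j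
  setAdjacent-off F a u v i j j≢a j≢sa = trans (setColumn-off _ (suc a) v i j j≢sa) (setColumn-off F a u i j j≢a)

  swapAdjacent : ℕ → Matrix → Matrix
  swapAdjacent a F = setAdjacent F a (λ i → F i (suc a)) (λ i → F i a)

  -- Swapping two adjacent columns negates the determinant: expand
  -- 0 = D(u+v, u+v) bilinearly, where D(x, y) puts x, y into columns a, a+1.
  det-swap-adjacent : ∀ n a F → suc a < n → detℕ n F + detℕ n (swapAdjacent a F) ≈ 0#
  det-swap-adjacent n a F sa<n = begin
    detℕ n F + detℕ n (swapAdjacent a F)  ≈⟨ +-cong (sym (detℕ-cong n (λ i j _ _ → unchanged i j))) refl ⟩
    D u v + D v u                          ≈⟨ +-cong (sym (+-identityˡ _)) (sym (+-identityʳ _)) ⟩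
    (0# + D u v) + (D v u + 0#)            ≈⟨ +-cong (+-cong (sym (D-equal u)) refl) (+-cong refl (sym (D-equal v))) ⟩
    (D u u + D u v) + (D v u + D v v)      ≈⟨ +-cong (sym (D-right u)) (sym (D-right v)) ⟩
    D u w + D v w                          ≈⟨ sym (D-left w) ⟩
    D w w                                  ≈⟨ D-equal w ⟩
    0#                                     ∎
    where
    u v w : ℕ → Carrier
    u i = F i a
    v i = F i (suc a)
    w i = u i + v i
    D : (ℕ → Carrier) → (ℕ → Carrier) → Carrier
    D x y = detℕ n (setAdjacent F a x y)
    D-left : ∀ y → D w y ≈ D u y + D v y
    D-left y = det-additive n a _ _ _ (N.<-trans (N.n<1+n a) sa<n)
      (λ i → trans (setAdjacent-a F a w y i) (sym (+-cong (setAdjacent-a F a u y i) (setAdjacent-a F a v y i))))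
      (setColumn-preserves a (suc a) y (setColumn-agreeOff F a w u))
      (setColumn-preserves a (suc a) y (setColumn-agreeOff F a w v))
    D-right : ∀ x → D x w ≈ D x u + D x v
    D-right x = det-additive n (suc a) _ _ _ sa<n
      (λ i → trans (setColumn-at Fx (suc a) w i) (sym (+-cong (setColumn-at Fx (suc a) u i) (setColumn-at Fx (suc a) v i))))
      (setColumn-agreeOff Fx (suc a) w u) (setColumn-agreeOff Fx (suc a) w v)
      where Fx : Matrix
            Fx = setColumn F a x
    D-equal : ∀ x → D x x ≈ 0#
    D-equal x = det-adjacent-equal n a (setAdjacent F a x x) sa<n
      (λ i → trans (setAdjacent-a F a x x i) (sym (setColumn-at (setColumn F a x) (suc a) x i)))
    unchanged : ∀ i j → setAdjacent F a u v i j ≈ F i j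
    unchanged i j = by-cases j (j ≟ a) (j ≟ suc a)
      where
      by-cases : ∀ j → Dec (j ≡ a) → Dec (j ≡ suc a) → setAdjacent F a u v i j ≈ F i j
      by-cases j (yes P.refl) _            = setAdjacent-a F a u v i
      by-cases j (no _)       (yes P.refl) = setColumn-at (setColumn F a u) (suc a) v i
      by-cases j (no j≢a)     (no j≢sa)    = setAdjacent-off F a u v i j j≢a j≢sa

  -- A matrix with two equal columns has determinant 0 (by induction on
  -- their distance, moving the right one leftwards by adjacent swaps).
  det-equal-columns-at : ∀ n d a F → suc a +ₙ d < n → (∀ i → F i a ≈ F i (suc a +ₙ d)) → detℕ n F ≈ 0#
  det-equal-columns-at n zero a F lt e =
    det-adjacent-equal n a F (P.subst (_< n) (N.+-identityʳ (suc a)) lt)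
      (λ i → trans (e i) (reflexive (P.cong (F i) (N.+-identityʳ (suc a)))))
  det-equal-columns-at n (suc d) a F lt e = begin
    detℕ n F                                         ≈⟨ sym (+-identityʳ _) ⟩
    detℕ n F + 0#                                     ≈⟨ +-cong refl (sym swapped-vanishes) ⟩
    detℕ n F + detℕ n (swapAdjacent b F)             ≈⟨ det-swap-adjacent n b F b+1<n ⟩
    0#                                                ∎
    where
    b : ℕ
    b = suc a +ₙ d
    b+1≡ : suc a +ₙ suc d ≡ suc b
    b+1≡ = N.+-suc (suc a) d
    b+1<n : suc b < n
    b+1<n = P.subst (_< n) b+1≡ lt
    a<b : a < b
    a<b = s≤s (N.m≤m+n a d)
    swapped-vanishes : detℕ n (swapAdjacent b F) ≈ 0#
    swapped-vanishes = det-equal-columns-at n d a (swapAdjacent b F) (N.<-trans (N.n<1+n b) b+1<n)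
      (λ i → trans (setAdjacent-off F b _ _ i a (N.<⇒≢ a<b) (N.<⇒≢ (N.m<n⇒m<1+n a<b)))
        (trans (e i) (trans (reflexive (P.cong (F i) b+1≡)) (sym (setAdjacent-a F b _ _ i)))))

  det-equal-columns : ∀ n a b F → a < n → b < n → a ≢ b → (∀ i → F i a ≈ F i b) → detℕ n F ≈ 0#
  det-equal-columns n a b F a<n b<n a≢b e with N.<-cmp a b
  ... | tri≈ _ q _ = ⊥-elim (a≢b q)
  ... | tri< a<b _ _ = det-equal-columns-at n (b ∸ suc a) a F (P.subst (_< n) (P.sym eq) b<n)
                         (λ i → trans (e i) (reflexive (P.cong (F i) (P.sym eq))))
    where eq : suc a +ₙ (b ∸ suc a) ≡ b
          eq = N.m+[n∸m]≡n a<b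
  ... | tri> _ _ b<a = det-equal-columns-at n (a ∸ suc b) b F (P.subst (_< n) (P.sym eq) a<n)
                         (λ i → trans (sym (e i)) (reflexive (P.cong (F i) (P.sym eq))))
    where eq : suc b +ₙ (a ∸ suc b) ≡ a
          eq = N.m+[n∸m]≡n b<a

  det-linear-sum : ∀ n K a (x : ℕ → Carrier) (V : Matrix) F → a < n →
    (∀ i → F i a ≈ sumTo K (λ s → x s * V s i)) →
    detℕ n F ≈ sumTo K (λ s → x s * detℕ n (setColumn F a (V s)))
  det-linear-sum n zero    a x V F a<n col = det-zero-column n a F a<n col
  det-linear-sum n (suc K) a x V F a<n col =
    trans (det-linear n a F (setColumn F a (V 0)) F' (x 0) 1# a<n
            (λ i → trans (col i) (+-cong (*-cong refl (sym (setColumn-at F a (V 0) i)))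
                                         (trans (sym (*-identityˡ _)) (*-cong refl (sym (setColumn-at F a _ i))))))
            (λ i j j≢a → sym (setColumn-off F a (V 0) i j j≢a))
            (λ i j j≢a → sym (setColumn-off F a _ i j j≢a)))
     (+-cong refl (trans (*-identityˡ _) (trans rest
       (sumTo-cong K (λ s _ → *-cong refl (detℕ-cong n (λ i j _ _ → overwrite s i j)))))))
    where
    F' : Matrix
    F' = setColumn F a (λ i → sumTo K (λ s → x (suc s) * V (suc s) i))
    rest : detℕ n F' ≈ sumTo K (λ s → x (suc s) * detℕ n (setColumn F' a (V (suc s))))
    rest = det-linear-sum n K a (λ s → x (suc s)) (λ s → V (suc s)) F' a<n (λ i → setColumn-at F a _ i)
    overwrite : ∀ s i j → setColumn F' a (V (suc s)) i j ≈ setColumn F a (V (suc s)) i j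
    overwrite s i j with j ≟ a
    ... | yes _   = refl
    ... | no j≢a  = setColumn-off F a _ i j j≢a

  mixColumns : Matrix → Matrix → ℕ → Matrix
  mixColumns A B t i j with j <? t
  ... | yes _ = A i j
  ... | no  _ = B i j

  mixColumns-< : ∀ A B t i j → j < t → mixColumns A B t i j ≈ A i j
  mixColumns-< A B t i j j<t with j <? t
  ... | yes _ = refl
  ... | no q  = ⊥-elim (q j<t)

  mixColumns-≥ : ∀ A B t i j → ¬ j < t → mixColumns A B t i j ≈ B i j
  mixColumns-≥ A B t i j j≮t with j <? t
  ... | yes q = ⊥-elim (j≮t q)
  ... | no _  = refl

  UpperTriangular : ℕ → Matrix → Set ℓ
  UpperTriangular N W = ∀ s j → j < s → s < N → W s j ≈ 0#

  -- Replacing column t of A·W by column t of A multiplies the determinant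
  -- by W_tt: column t of A·W is Σ_{s≤t} W_st A_s, and for s < t the column
  -- A_s already occurs.
  det-mix-step : ∀ N (A W : Matrix) t → UpperTriangular N W → t < N →
    detℕ N (mixColumns A (λ i j → sumTo N (λ s → A i s * W s j)) t)
      ≈ W t t * detℕ N (mixColumns A (λ i j → sumTo N (λ s → A i s * W s j)) (suc t))
  det-mix-step N A W t upper t<N =
    trans (det-linear-sum N N t (λ s → W s t) (λ s i → A i s) (M t) t<N column-t)
      (trans (sumTo-single N t (λ s → W s t * detℕ N (setColumn (M t) t (λ i → A i s))) t<N others)
        (*-cong refl (detℕ-cong N (λ i j _ _ → next i j))))
    where
    AW : Matrix
    AW i j = sumTo N (λ s → A i s * W s j)
    M : ℕ → Matrix
    M = mixColumns A AW
    column-t : ∀ i → M t i t ≈ sumTo N (λ s → W s t * A i s)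
    column-t i = trans (mixColumns-≥ A AW t i t (N.<-irrefl P.refl)) (sumTo-cong N (λ s _ → *-comm _ _))
    others : ∀ s → s < N → s ≢ t → W s t * detℕ N (setColumn (M t) t (λ i → A i s)) ≈ 0#
    others s s<N s≢t with N.<-cmp s t
    ... | tri≈ _ q _ = ⊥-elim (s≢t q)
    ... | tri> _ _ t<s = trans (*-cong (upper s t t<s s<N) refl) (zeroˡ _)
    ... | tri< s<t _ _ = trans (*-cong refl (det-equal-columns N s t (setColumn (M t) t (λ i → A i s)) s<N t<N s≢t
            (λ i → trans (setColumn-off (M t) t _ i s s≢t)
                     (trans (mixColumns-< A AW t i s s<t) (sym (setColumn-at (M t) t (λ i → A i s) i))))))
          (zeroʳ _)
    next : ∀ i j → setColumn (M t) t (λ i → A i t) i j ≈ M (suc t) i j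
    next i j = by-cases j (j ≟ t)
      where
      unchanged : ∀ j → j ≢ t → Dec (j < t) → M t i j ≈ M (suc t) i j
      unchanged j _ (yes j<t) = trans (mixColumns-< A AW t i j j<t) (sym (mixColumns-< A AW (suc t) i j (N.m<n⇒m<1+n j<t)))
      unchanged j j≢t (no j≮t) = trans (mixColumns-≥ A AW t i j j≮t)
        (sym (mixColumns-≥ A AW (suc t) i j (λ j<t+1 → j≮t (N.≤∧≢⇒< (N.≤-pred j<t+1) j≢t))))
      by-cases : ∀ j → Dec (j ≡ t) → setColumn (M t) t (λ i → A i t) i j ≈ M (suc t) i j
      by-cases j (yes P.refl) = trans (setColumn-at (M t) t _ i) (sym (mixColumns-< A AW (suc j) i j (N.n<1+n j)))
      by-cases j (no j≢t)     = trans (setColumn-off (M t) t _ i j j≢t) (unchanged j j≢t (j <? t))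

  det-mul-upper : ∀ N (A W H : Matrix) → UpperTriangular N W →
    (∀ i j → i < N → j < N → H i j ≈ sumTo N (λ s → A i s * W s j)) →
    detℕ N H ≈ detℕ N A * prodTo N (λ j → W j j)
  det-mul-upper N A W H upper H≈AW = begin
    detℕ N H          ≈⟨ detℕ-cong N (λ i j i<N j<N → trans (H≈AW i j i<N j<N) (sym (mixColumns-≥ A AW 0 i j (λ ())))) ⟩
    detℕ N (M 0)      ≈⟨ peel N N.≤-refl ⟩
    prodTo N (λ j → W j j) * detℕ N (M N)
                      ≈⟨ *-comm _ _ ⟩
    detℕ N (M N) * prodTo N (λ j → W j j)
                      ≈⟨ *-cong (detℕ-cong N (λ i j _ j<N → mixColumns-< A AW N i j j<N)) refl ⟩
    detℕ N A * prodTo N (λ j → W j j) ∎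
    where
    AW : Matrix
    AW i j = sumTo N (λ s → A i s * W s j)
    M : ℕ → Matrix
    M = mixColumns A AW
    peel : ∀ t → t ≤ N → detℕ N (M 0) ≈ prodTo t (λ j → W j j) * detℕ N (M t)
    peel zero    _     = sym (*-identityˡ _)
    peel (suc t) t<N = trans (peel t (N.<⇒≤ t<N))
      (trans (*-cong refl (det-mix-step N A W t upper t<N))
        (trans (sym (*-assoc _ _ _)) (*-cong (sym (prodTo-last t (λ j → W j j))) refl)))

  det-first-row : ∀ n F → (∀ p → 0 < p → p < suc n → F 0 p ≈ 0#) →
    detℕ (suc n) F ≈ F 0 0 * detℕ n (λ i k → F (suc i) (suc k))
  det-first-row n F e =
    trans (laplace n F)
      (trans (sumTo-single (suc n) 0 (λ p → sgn R p * (F 0 p * detℕ n (minor p F))) (s≤s z≤n)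
               (λ p p<n p≢0 → trans (*-cong refl (trans (*-cong (e p (N.n≢0⇒n>0 p≢0) p<n) refl) (zeroˡ _))) (zeroʳ _)))
        (*-identityˡ _))

  det-zero-first-row : ∀ n F → (∀ p → p < suc n → F 0 p ≈ 0#) → detℕ (suc n) F ≈ 0#
  det-zero-first-row n F e = trans (laplace n F) (sumTo-zero (suc n) {λ p → sgn R p * (F 0 p * detℕ n (minor p F))} (λ p p<n →
    trans (*-cong refl (trans (*-cong (e p p<n) refl) (zeroˡ _))) (zeroʳ _)))

  suc-C2 : ∀ p → suc p C 2 ≡ p +ₙ p C 2
  suc-C2 p = P.trans (P.sym (nCk+nC[k+1]≡[n+1]C[k+1] p 1)) (P.cong (_+ₙ p C 2) (nC1≡n p))

  det-antidiagonal : ∀ p n F → (∀ t k → t < p → k < p +ₙ n → k ≢ p ∸ suc t → F t k ≈ 0#) →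
    detℕ (p +ₙ n) F ≈ (sgn R (p C 2) * prodTo p (λ t → F t (p ∸ suc t))) * detℕ n (λ i k → F (p +ₙ i) (p +ₙ k))
  det-antidiagonal zero    n F e = sym (trans (*-cong (*-identityˡ 1#) refl) (*-identityˡ _))
  det-antidiagonal (suc p) n F e =
    trans (laplace (p +ₙ n) F)
    (trans (sumTo-single (suc (p +ₙ n)) p T (s≤s (N.m≤m+n p n))
             (λ k k<n k≢p → trans (*-cong refl (trans (*-cong (e 0 k (s≤s z≤n) k<n k≢p) refl) (zeroˡ _))) (zeroʳ _)))
    (trans (*-cong refl (*-cong refl (trans rest (*-cong
             (*-cong refl (prodTo-cong p (λ t t<p → reflexive (P.cong (F (suc t)) (punchInℕ-< p (p ∸ suc t) (antidiagonal< t t<p))))))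
             (detℕ-cong n (λ i k _ _ → reflexive (P.cong (F (suc (p +ₙ i))) (punchInℕ-≥ p (p +ₙ k) (N.m≤m+n p k)))))))))
    (trans (regroup (sgn R p) (F 0 p) (sgn R (p C 2)) _ _)
      (*-cong (*-cong (sym (trans (reflexive (P.cong (sgn R) (suc-C2 p))) (sgn-+ p (p C 2)))) refl) refl))))
    where
    T : ℕ → Carrier
    T k = sgn R k * (F 0 k * detℕ (p +ₙ n) (minor k F))
    antidiagonal< : ∀ t → t < p → p ∸ suc t < p
    antidiagonal< t t<p = N.∸-monoʳ-< (s≤s z≤n) t<p
    rest : detℕ (p +ₙ n) (minor p F)
           ≈ (sgn R (p C 2) * prodTo p (λ t → minor p F t (p ∸ suc t))) * detℕ n (λ i k → minor p F (p +ₙ i) (p +ₙ k))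
    rest = det-antidiagonal p n (minor p F) (λ t k t<p k<n k≢ →
             e (suc t) (punchInℕ p k) (s≤s t<p) (punchInℕ-bound p k (p +ₙ n) (s≤s (N.m≤m+n p n)) k<n)
               (λ q → k≢ (punchInℕ-below p k _ q (antidiagonal< t t<p))))
    regroup : ∀ s f s₂ π d → s * (f * ((s₂ * π) * d)) ≈ ((s * s₂) * (f * π)) * d
    regroup = solve 5 (λ s f s₂ π d → s :* (f :* ((s₂ :* π) :* d)) := ((s :* s₂) :* (f :* π)) :* d) refl

  δ : ℕ → ℕ → Carrier
  δ x y with x ≟ y
  ... | yes _ = 1#
  ... | no _  = 0#

  δ-≢ : ∀ x y → x ≢ y → δ x y ≈ 0#
  δ-≢ x y x≢y with x ≟ y
  ... | yes q = ⊥-elim (x≢y q)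
  ... | no _  = refl

  δ-≡ : ∀ x → δ x x ≈ 1#
  δ-≡ x with x ≟ x
  ... | yes _ = refl
  ... | no q  = ⊥-elim (q P.refl)

  -- The number of walks of length n from x to y with steps ±1 that never go
  -- below 0, counted in R (indexed by the first step).
  walks : ℕ → ℕ → ℕ → Carrier
  walks zero    x       y = δ x y
  walks (suc n) zero    y = walks n 1 y
  walks (suc n) (suc x) y = walks n (suc (suc x)) y + walks n x y

  walks-out-of-reach-above : ∀ n x y → n +ₙ x < y → walks n x y ≈ 0#
  walks-out-of-reach-above zero    x       y lt = δ-≢ x y (λ q → N.<-irrefl q lt)
  walks-out-of-reach-above (suc n) zero    y lt =
    walks-out-of-reach-above n 1 y (P.subst (_< y) (P.trans (N.+-identityʳ (suc n)) (N.+-comm 1 n)) lt)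
  walks-out-of-reach-above (suc n) (suc x) y lt = trans (+-cong
      (walks-out-of-reach-above n (suc (suc x)) y (P.subst (_< y) (P.sym (N.+-suc n (suc x))) lt))
      (walks-out-of-reach-above n x y (N.<-trans (N.n<1+n _) (N.<-trans (N.n<1+n _) (P.subst (λ z → suc z < y) (N.+-suc n x) lt)))))
    (+-identityˡ 0#)

  walks-out-of-reach-below : ∀ n x y → n +ₙ y < x → walks n x y ≈ 0#
  walks-out-of-reach-below zero    x       y lt = δ-≢ x y (λ q → N.<-irrefl (P.sym q) lt)
  walks-out-of-reach-below (suc n) zero    y ()
  walks-out-of-reach-below (suc n) (suc x) y (s≤s lt) = trans (+-cong
      (walks-out-of-reach-below n (suc (suc x)) y (N.<-trans lt (N.<-trans (N.n<1+n x) (N.n<1+n (suc x)))))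
      (walks-out-of-reach-below n x y lt))
    (+-identityˡ 0#)

  Odd : ℕ → Set
  Odd s = Σ ℕ (λ k → s ≡ suc (k +ₙ k))

  double-not-odd : ∀ x → ¬ Odd (x +ₙ x)
  double-not-odd zero    (k , ())
  double-not-odd (suc x) (zero , q)  = N.1+n≢0 (P.trans (P.sym (N.+-suc x x)) (N.suc-injective q))
  double-not-odd (suc x) (suc k , q) = double-not-odd x (k , N.suc-injective
    (P.trans (P.sym (N.+-suc x x)) (P.trans (N.suc-injective q) (P.cong suc (N.+-suc k k)))))

  odd-pred₂ : ∀ s → Odd (suc (suc s)) → Odd s
  odd-pred₂ s (zero , ())
  odd-pred₂ s (suc k , q) = k , P.trans (N.suc-injective (N.suc-injective q)) (N.+-suc k k)

  -- Every step changes the parity of the position.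
  walks-parity : ∀ n x y → Odd (n +ₙ x +ₙ y) → walks n x y ≈ 0#
  walks-parity zero    x       y o = δ-≢ x y (λ { P.refl → double-not-odd x o })
  walks-parity (suc n) zero    y o =
    walks-parity n 1 y (P.subst Odd (P.cong (_+ₙ y) (P.trans (N.+-identityʳ (suc n)) (N.+-comm 1 n))) o)
  walks-parity (suc n) (suc x) y o = trans (+-cong
      (walks-parity n (suc (suc x)) y (P.subst Odd (P.cong (_+ₙ y) (P.sym (N.+-suc n (suc x)))) o))
      (walks-parity n x y (odd-pred₂ _ (P.subst Odd (P.cong (λ z → suc z +ₙ y) (N.+-suc n x)) o))))
    (+-identityˡ 0#)

  -- Splitting a walk of length a+e at time a (positions stay below x+a < B).
  walks-split : ∀ a e x y B → x +ₙ a < B → walks (a +ₙ e) x y ≈ sumTo B (λ h → walks a x h * walks e h y)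
  walks-split zero e x y B lt = sym (trans
    (sumTo-single B x _ (P.subst (_< B) (N.+-identityʳ x) lt)
       (λ h _ h≢x → trans (*-cong (δ-≢ x h (λ q → h≢x (P.sym q))) refl) (zeroˡ _)))
    (trans (*-cong (δ-≡ x) refl) (*-identityˡ _)))
  walks-split (suc a) e zero    y B lt = walks-split a e 1 y B lt
  walks-split (suc a) e (suc x) y B lt = trans (+-cong
      (walks-split a e (suc (suc x)) y B (P.subst (λ z → suc z < B) (N.+-suc x a) lt))
      (walks-split a e x y B (N.<-trans (N.n<1+n _) (N.<-trans (N.n<1+n _) (P.subst (λ z → suc z < B) (N.+-suc x a) lt)))))
    (trans (sym (sumTo-+ B _ _)) (sumTo-cong B (λ h _ → sym (distribʳ _ _ _))))

  walks-straight-down : ∀ n → walks n n 0 ≈ 1#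
  walks-straight-down zero    = refl
  walks-straight-down (suc n) = trans (+-cong
      (walks-out-of-reach-below n (suc (suc n)) 0
        (P.subst (_< suc (suc n)) (P.sym (N.+-identityʳ n)) (N.<-trans (N.n<1+n n) (N.n<1+n (suc n)))))
      (walks-straight-down n))
    (+-identityˡ 1#)

  walks-straight-up : ∀ n x → walks n x (x +ₙ n) ≈ 1#
  walks-straight-up zero    x       = trans (reflexive (P.cong (walks 0 x) (N.+-identityʳ x))) (δ-≡ x)
  walks-straight-up (suc n) zero    = walks-straight-up n 1
  walks-straight-up (suc n) (suc x) = trans (+-cong
      (trans (reflexive (P.cong (walks n (suc (suc x))) (N.+-suc (suc x) n))) (walks-straight-up n (suc (suc x))))
      (walks-out-of-reach-above n x (suc x +ₙ suc n)
        (P.subst (_< suc x +ₙ suc n) (N.+-comm x n) (s≤s (N.+-monoʳ-≤ x (N.n≤1+n n))))))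
    (+-identityʳ 1#)

  -- Cauchy products of coefficient sequences, and the Catalan recurrence
  -- for closed walks.

  conv : (ℕ → Carrier) → (ℕ → Carrier) → ℕ → Carrier
  conv f g n = sumTo (suc n) (λ a → f a * g (n ∸ a))

  sumTo-triangle : ∀ n (F : ℕ → ℕ → Carrier) →
    sumTo (suc n) (λ c → sumTo (suc c) (λ a → F c a)) ≈ sumTo (suc n) (λ a → sumTo (suc (n ∸ a)) (λ b → F (a +ₙ b) a))
  sumTo-triangle zero    F = refl
  sumTo-triangle (suc n) F =
    trans (sumTo-last (suc n) (λ c → sumTo (suc c) (λ a → F c a))) (trans (+-cong (sumTo-triangle n F) refl) (sym new-row))
    where
    g h : ℕ → Carrier
    g a = sumTo (suc (suc n ∸ a)) (λ b → F (a +ₙ b) a)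
    h a = sumTo (suc (n ∸ a)) (λ b → F (a +ₙ b) a)
    g-last : ∀ a → a < suc n → g a ≈ h a + F (suc n) a
    g-last a (s≤s a≤n) = trans (reflexive (P.cong (λ z → sumTo (suc z) (λ b → F (a +ₙ b) a)) (N.+-∸-assoc 1 a≤n)))
       (trans (sumTo-last (suc (n ∸ a)) (λ b → F (a +ₙ b) a))
         (+-cong refl (reflexive (P.cong (λ z → F z a) (P.trans (N.+-suc a (n ∸ a)) (P.cong suc (N.m+[n∸m]≡n a≤n)))))))
    g-corner : g (suc n) ≈ F (suc n) (suc n)
    g-corner = trans (reflexive (P.cong (λ z → sumTo (suc z) (λ b → F (suc n +ₙ b) (suc n))) (N.n∸n≡0 n)))
       (trans (+-identityʳ _) (reflexive (P.cong (λ z → F z (suc n)) (N.+-identityʳ (suc n)))))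
    new-row : sumTo (suc (suc n)) g ≈ sumTo (suc n) h + sumTo (suc (suc n)) (λ a → F (suc n) a)
    new-row = trans (sumTo-last (suc n) g)
      (trans (+-cong (trans (sumTo-cong (suc n) {g} {λ a → h a + F (suc n) a} g-last) (sumTo-+ (suc n) h (λ a → F (suc n) a))) g-corner)
        (trans (+-assoc _ _ _) (+-cong refl (sym (sumTo-last (suc n) (λ a → F (suc n) a))))))

  conv-cong : ∀ {f f' g g'} n → (∀ k → k ≤ n → f k ≈ f' k) → (∀ k → k ≤ n → g k ≈ g' k) → conv f g n ≈ conv f' g' n
  conv-cong n ef eg = sumTo-cong (suc n) (λ a a<n → *-cong (ef a (N.≤-pred a<n)) (eg (n ∸ a) (N.m∸n≤m n a)))

  conv-assoc : ∀ f g h n → conv (conv f g) h n ≈ conv f (conv g h) n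
  conv-assoc f g h n =
    trans (sumTo-cong (suc n) {λ c → conv f g c * h (n ∸ c)} {λ c → sumTo (suc c) (λ a → F c a)}
             (λ c _ → sumTo-*ʳ (suc c) (h (n ∸ c)) (λ a → f a * g (c ∸ a))))
    (trans (sumTo-triangle n F)
    (sumTo-cong (suc n) {λ a → sumTo (suc (n ∸ a)) (λ b → F (a +ₙ b) a)} {λ a → f a * conv g h (n ∸ a)}
       (λ a _ → trans (sumTo-cong (suc (n ∸ a)) {λ b → F (a +ₙ b) a} {λ b → f a * (g b * h ((n ∸ a) ∸ b))}
          (λ b _ → trans (*-assoc _ _ _)
             (*-cong refl (*-cong (reflexive (P.cong g (N.m+n∸m≡n a b))) (reflexive (P.cong h (P.sym (N.∸-+-assoc n a b))))))))
          (sym (sumTo-*ˡ (suc (n ∸ a)) (f a) (λ b → g b * h (n ∸ a ∸ b)))))))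
    where
    F : ℕ → ℕ → Carrier
    F c a = (f a * g (c ∸ a)) * h (n ∸ c)

  shift : (ℕ → Carrier) → ℕ → Carrier
  shift φ zero    = 0#
  shift φ (suc d) = φ d

  conv-shiftˡ : ∀ φ g k → conv (shift φ) g k ≈ shift (conv φ g) k
  conv-shiftˡ φ g zero    = trans (+-identityʳ _) (zeroˡ _)
  conv-shiftˡ φ g (suc k) = trans (+-cong (zeroˡ _) refl) (+-identityˡ _)

  conv-shiftʳ : ∀ f φ k → conv f (shift φ) k ≈ shift (conv f φ) k
  conv-shiftʳ f φ zero    = trans (+-identityʳ _) (zeroʳ _)
  conv-shiftʳ f φ (suc k) = trans (sumTo-last (suc k) (λ a → f a * shift φ (suc k ∸ a)))
    (trans (+-cong (sumTo-cong (suc k) {λ a → f a * shift φ (suc k ∸ a)} {λ a → f a * φ (k ∸ a)}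
                      (λ a a<k → *-cong refl (reflexive (P.cong (shift φ) (N.+-∸-assoc 1 (N.≤-pred a<k))))))
                   (trans (*-cong (refl {x = f (suc k)}) (reflexive (P.cong (shift φ) (N.n∸n≡0 (suc k))))) (zeroʳ _)))
      (+-identityʳ _))

  -- Closed walks from 0 (Dyck paths; their numbers are the Catalan numbers).
  dyck : ℕ → Carrier
  dyck d = walks d 0 0

  descents : ℕ → ℕ → Carrier
  descents x d = walks d x 0

  -- Decomposing at the first return to level x+1: a walk from x+1 to 0 of
  -- length k+1 is a closed walk from x+1 followed by a step down and a walk
  -- from x to 0; proved by strong induction on the length, k ≤ n.
  first-return : ∀ n k → k ≤ n → ∀ x → walks (suc k) (suc x) 0 ≈ conv dyck (descents x) k
  first-return n zero _ x = trans (+-identityˡ _) (sym (trans (+-identityʳ _) (*-identityˡ _)))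
  first-return (suc n) (suc k) (s≤s k≤n) x = trans (+-cong from-above (sym (*-identityˡ _))) (+-comm _ _)
    where
    descents-shift : ∀ y d → d ≤ k → descents (suc y) d ≈ shift (conv dyck (descents y)) d
    descents-shift y zero    _   = refl
    descents-shift y (suc d) d<k = first-return n d (N.≤-trans (N.<⇒≤ d<k) k≤n) y
    dyck-shift : ∀ a → a ≤ k → dyck (suc a) ≈ shift (conv dyck dyck) a
    dyck-shift zero    _   = refl
    dyck-shift (suc a) a<k = first-return n a (N.≤-trans (N.<⇒≤ a<k) k≤n) 0
    shift-assoc : ∀ k → shift (conv (conv dyck dyck) (descents x)) k ≈ shift (conv dyck (conv dyck (descents x))) k
    shift-assoc zero    = refl
    shift-assoc (suc k) = conv-assoc dyck dyck (descents x) k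
    from-above : walks (suc k) (suc (suc x)) 0 ≈ sumTo (suc k) (λ a → dyck (suc a) * descents x (k ∸ a))
    from-above = begin
      walks (suc k) (suc (suc x)) 0                         ≈⟨ first-return n k k≤n (suc x) ⟩
      conv dyck (descents (suc x)) k                         ≈⟨ conv-cong {dyck} {dyck} k (λ _ _ → refl) (descents-shift x) ⟩
      conv dyck (shift (conv dyck (descents x))) k           ≈⟨ conv-shiftʳ dyck (conv dyck (descents x)) k ⟩
      shift (conv dyck (conv dyck (descents x))) k           ≈⟨ sym (shift-assoc k) ⟩
      shift (conv (conv dyck dyck) (descents x)) k           ≈⟨ sym (conv-shiftˡ (conv dyck dyck) (descents x) k) ⟩
      conv (shift (conv dyck dyck)) (descents x) k           ≈⟨ sym (conv-cong {g = descents x} k dyck-shift (λ _ _ → refl)) ⟩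
      sumTo (suc k) (λ a → dyck (suc a) * descents x (k ∸ a)) ∎

  catalan : ∀ n → dyck (suc (suc n)) ≈ conv dyck dyck n
  catalan n = first-return n n N.≤-refl 0

  conv-multiples : ∀ μ' t (f g : ℕ → Carrier) →
    (∀ k r → 0 < r → r < suc μ' → k < suc t → f (k *ₙ suc μ' +ₙ r) ≈ 0#) →
    conv f g (t *ₙ suc μ') ≈ sumTo (suc t) (λ k → f (k *ₙ suc μ') * g ((t ∸ k) *ₙ suc μ'))
  conv-multiples μ' t f g f-sparse =
    trans extend (trans (sumTo-multiples μ (suc t) h (s≤s z≤n) (λ k r 0<r r<μ k<t → trans (*-cong (f-sparse k r 0<r r<μ k<t) refl) (zeroˡ _)))
      (sumTo-cong (suc t) {λ k → h (k *ₙ μ)} {λ k → f (k *ₙ μ) * g ((t ∸ k) *ₙ μ)}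
        (λ k _ → *-cong refl (reflexive (P.cong g (P.sym (N.*-distribʳ-∸ μ t k)))))))
    where
    μ : ℕ
    μ = suc μ'
    h : ℕ → Carrier
    h a = f a * g (t *ₙ μ ∸ a)
    extend : sumTo (suc (t *ₙ μ)) h ≈ sumTo (suc t *ₙ μ) h
    extend = sumTo-extend (suc (t *ₙ μ)) (suc t *ₙ μ) h (s≤s (N.m≤n+m (t *ₙ μ) μ'))
      (λ s tμ<s s<M → trans (*-cong (vanish s tμ<s s<M) refl) (zeroˡ _))
      where
      vanish : ∀ s → suc (t *ₙ μ) ≤ s → s < suc t *ₙ μ → f s ≈ 0#
      vanish s tμ<s s<M = trans (reflexive (P.cong f (P.sym (N.m+[n∸m]≡n (N.<⇒≤ tμ<s)))))
        (f-sparse t (s ∸ t *ₙ μ) (N.m<n⇒0<n∸m tμ<s)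
          (N.+-cancelˡ-< (t *ₙ μ) _ _ (P.subst (_< t *ₙ μ +ₙ μ) (P.sym (N.m+[n∸m]≡n (N.<⇒≤ tμ<s)))
                                         (P.subst (s <_) (N.+-comm μ (t *ₙ μ)) s<M)))
          (N.n<1+n t))

  dyck-odd : ∀ k → dyck (k *ₙ 2 +ₙ 1) ≈ 0#
  dyck-odd k = walks-parity (k *ₙ 2 +ₙ 1) 0 0 (k , odd k)
    where odd : ∀ k → k *ₙ 2 +ₙ 1 +ₙ 0 +ₙ 0 ≡ suc (k +ₙ k)
          odd = solve-∀

  module Coefficients (m' : ℕ) (b : Carrier) (f : PowerSeries R) (isF : IsFm R (suc m') b f) where

    m : ℕ
    m = suc m'

    monomial-low : ∀ n → ¬ m ≤ n → monoMulS R b m (mulS R f f) n ≈ 0#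
    monomial-low n m≰n with m ≤? n
    ... | yes m≤n = ⊥-elim (m≰n m≤n)
    ... | no _    = refl

    monomial-high : ∀ n → m ≤ n → monoMulS R b m (mulS R f f) n ≈ b * conv f f (n ∸ m)
    monomial-high n m≤n with m ≤? n
    ... | yes _   = *-cong refl (sumFin≈sumTo (suc (n ∸ m)) (λ a → f a * f ((n ∸ m) ∸ a)))
    ... | no m≰n  = ⊥-elim (m≰n m≤n)

    AtMultiple : ℕ → Set ℓ
    AtMultiple n = ∀ t → n ≡ t *ₙ m → f n ≈ dyck (t *ₙ 2) * pow R b t

    OffMultiple : ℕ → Set ℓ
    OffMultiple n = ∀ t r → 0 < r → r < m → n ≡ t *ₙ m +ₙ r → f n ≈ 0#

    Shape : ℕ → Set ℓ
    Shape n = AtMultiple n × OffMultiple n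

    -- f((t+1)m) = b Σ_{k≤t} f(km) f((t-k)m) = b^(t+1) Σ_{k≤t} C_k C_(t-k) = C_(t+1) b^(t+1).
    shape-at : ∀ n → (∀ {a} → a < n → Shape a) → AtMultiple n
    shape-at n ih zero    P.refl = trans (isF 0) (trans (+-identityʳ _) (sym (*-identityˡ _)))
    shape-at n ih (suc t) P.refl = begin
      f n                                                        ≈⟨ isF n ⟩
      oneS R n + monoMulS R b m (mulS R f f) n                   ≈⟨ +-cong refl (monomial-high n (N.m≤m+n m (t *ₙ m))) ⟩
      0# + b * conv f f (n ∸ m)                                  ≈⟨ +-identityˡ _ ⟩
      b * conv f f (n ∸ m)                                       ≈⟨ *-cong refl (reflexive (P.cong (conv f f) (N.m+n∸m≡n m (t *ₙ m)))) ⟩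
      b * conv f f (t *ₙ m)                                      ≈⟨ *-cong refl (conv-multiples m' t f f off-multiples) ⟩
      b * sumTo (suc t) (λ k → f (k *ₙ m) * f ((t ∸ k) *ₙ m))    ≈⟨ *-cong refl (sumTo-cong (suc t) products) ⟩
      b * sumTo (suc t) (λ k → pow R b t * (dyck (k *ₙ 2) * dyck ((t ∸ k) *ₙ 2)))
                                                                 ≈⟨ *-cong refl (sym (sumTo-*ˡ (suc t) (pow R b t) (λ k → dyck (k *ₙ 2) * dyck ((t ∸ k) *ₙ 2)))) ⟩
      b * (pow R b t * sumTo (suc t) (λ k → dyck (k *ₙ 2) * dyck ((t ∸ k) *ₙ 2)))
                                                                 ≈⟨ *-cong refl (*-cong refl (sym (conv-multiples 1 t dyck dyck dyck-sparse))) ⟩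
      b * (pow R b t * conv dyck dyck (t *ₙ 2))                  ≈⟨ *-cong refl (*-cong refl (sym (catalan (t *ₙ 2)))) ⟩
      b * (pow R b t * dyck (suc t *ₙ 2))                        ≈⟨ solve 3 (λ b p d → b :* (p :* d) := d :* (b :* p)) refl b _ _ ⟩
      dyck (suc t *ₙ 2) * pow R b (suc t)                        ∎
      where
      km<n : ∀ k → k < suc t → k *ₙ m < n
      km<n k (s≤s k≤t) = N.<-≤-trans (N.m<m+n (k *ₙ m) (s≤s z≤n))
        (P.subst (_≤ n) (N.+-comm m (k *ₙ m)) (N.+-monoʳ-≤ m (N.*-monoˡ-≤ m k≤t)))
      off-multiples : ∀ k r → 0 < r → r < m → k < suc t → f (k *ₙ m +ₙ r) ≈ 0#
      off-multiples k r 0<r r<m k<st = proj₂ (ih (N.<-≤-trans (N.+-monoʳ-< (k *ₙ m) r<m)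
        (P.subst (_≤ n) (N.+-comm m (k *ₙ m)) (N.+-monoʳ-≤ m (N.*-monoˡ-≤ m (N.≤-pred k<st)))))) k r 0<r r<m P.refl
      products : ∀ k → k < suc t → f (k *ₙ m) * f ((t ∸ k) *ₙ m) ≈ pow R b t * (dyck (k *ₙ 2) * dyck ((t ∸ k) *ₙ 2))
      products k k<st = trans (*-cong (proj₁ (ih (km<n k k<st)) k P.refl)
                                      (proj₁ (ih (km<n (t ∸ k) (s≤s (N.m∸n≤m t k)))) (t ∸ k) P.refl))
        (trans (solve 4 (λ x p y q → (x :* p) :* (y :* q) := (p :* q) :* (x :* y)) refl _ _ _ _)
          (*-cong (trans (sym (pow-+ b k (t ∸ k))) (reflexive (P.cong (pow R b) (N.m+[n∸m]≡n (N.≤-pred k<st))))) refl))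
      dyck-sparse : ∀ k r → 0 < r → r < 2 → k < suc t → dyck (k *ₙ 2 +ₙ r) ≈ 0#
      dyck-sparse k (suc zero) _ _ _ = dyck-odd k
      dyck-sparse k (suc (suc r)) _ (s≤s (s≤s ())) _

    -- Below n only multiples of m contribute, so the Cauchy square of f at
    -- n - m (which is not a multiple of m) has no surviving term.
    shape-off : ∀ n → (∀ {a} → a < n → Shape a) → OffMultiple n
    shape-off n ih zero (suc r) _ r<m P.refl =
      trans (isF (suc r))
        (trans (+-cong refl (monomial-low (suc r) (λ m≤r → N.<-irrefl P.refl (N.<-≤-trans r<m m≤r)))) (+-identityˡ 0#))
    shape-off n ih (suc t) r 0<r r<m P.refl = begin
      f n                                           ≈⟨ isF n ⟩
      oneS R n + monoMulS R b m (mulS R f f) n      ≈⟨ +-cong refl (monomial-high n m≤n) ⟩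
      0# + b * conv f f (n ∸ m)                     ≈⟨ +-identityˡ _ ⟩
      b * conv f f (n ∸ m)                          ≈⟨ *-cong refl (reflexive (P.cong (conv f f) n∸m≡n')) ⟩
      b * conv f f n'                               ≈⟨ *-cong refl (sumTo-zero (suc n') (λ a a<n'+1 → term a (N.≤-pred a<n'+1))) ⟩
      b * 0#                                        ≈⟨ zeroʳ b ⟩
      0#                                            ∎
      where
      n' : ℕ
      n' = t *ₙ m +ₙ r
      n∸m≡n' : n ∸ m ≡ n'
      n∸m≡n' = P.trans (P.cong (_∸ m) (N.+-assoc m (t *ₙ m) r)) (N.m+n∸m≡n m (t *ₙ m +ₙ r))
      m≤n : m ≤ n
      m≤n = N.≤-trans (N.m≤m+n m (t *ₙ m)) (N.m≤m+n _ r)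
      n'<n : n' < n
      n'<n = P.subst (n' <_) (P.sym (N.+-assoc m (t *ₙ m) r)) (N.m<n+m n' {m} (s≤s z≤n))
      term : ∀ a → a ≤ n' → f a * f (n' ∸ a) ≈ 0#
      term a a≤n' with a % m ≟ 0
      ... | no a%m≢0 = trans (*-cong (proj₂ (ih (N.≤-<-trans a≤n' n'<n)) (a / m) (a % m) (N.n≢0⇒n>0 a%m≢0) (m%n<n a m)
                                      (P.trans (m≡m%n+[m/n]*n a m) (N.+-comm (a % m) _))) refl) (zeroˡ _)
      ... | yes a%m≡0 = trans (*-cong refl (proj₂ (ih (N.≤-<-trans (N.m∸n≤m n' a) n'<n)) (t ∸ q) r 0<r r<m complement)) (zeroʳ _)
        where
        q : ℕ
        q = a / m
        a≡qm : a ≡ q *ₙ m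
        a≡qm = P.trans (m≡m%n+[m/n]*n a m) (P.cong (_+ₙ q *ₙ m) a%m≡0)
        q≤t : q ≤ t
        q≤t = N.≤-pred (N.*-cancelʳ-< m q (suc t) (P.subst (_< suc t *ₙ m) a≡qm
                (N.≤-<-trans a≤n' (P.subst (n' <_) (N.+-comm (t *ₙ m) m) (N.+-monoʳ-< (t *ₙ m) r<m)))))
        complement : n' ∸ a ≡ (t ∸ q) *ₙ m +ₙ r
        complement = P.trans (P.cong (n' ∸_) a≡qm) (P.trans (N.+-∸-comm r (N.*-monoˡ-≤ m q≤t))
                       (P.cong (_+ₙ r) (P.sym (N.*-distribʳ-∸ m t q))))

    shape : ∀ n → Shape n
    shape = <-rec Shape (λ n ih → shape-at n ih , shape-off n ih)

    coeff-multiple : ∀ t → f (t *ₙ m) ≈ dyck (t *ₙ 2) * pow R b t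
    coeff-multiple t = proj₁ (shape (t *ₙ m)) t P.refl

    coeff-off : ∀ t r → 0 < r → r < m → f (t *ₙ m +ₙ r) ≈ 0#
    coeff-off t r 0<r r<m = proj₂ (shape (t *ₙ m +ₙ r)) t r 0<r r<m P.refl

  -- Index i is written as
  -- i = (i / m)·m + (i % m); carry r is 1 for r > 0, complement r is the
  -- residue r' with r + r' ≡ 0 (mod m), so that for i = q'm + r',
  -- j = qm + r the sum i + j is a multiple of m exactly when
  -- r = complement r', namely (q' + q + carry r')·m.
  module Hankel (m' : ℕ) (b : Carrier) (f : PowerSeries R) (isF : IsFm R (suc m') b f) where

    open Coefficients m' b f isF

    carry : ℕ → ℕ
    carry zero    = 0
    carry (suc _) = 1

    complement : ℕ → ℕ
    complement zero    = 0
    complement (suc r) = m ∸ suc r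

    divmod : ∀ x → x ≡ x / m *ₙ m +ₙ x % m
    divmod x = P.trans (m≡m%n+[m/n]*n x m) (N.+-comm (x % m) _)

    rem-of : ∀ q r → r < m → (q *ₙ m +ₙ r) % m ≡ r
    rem-of q r r<m = P.trans (P.cong (_% m) (N.+-comm (q *ₙ m) r)) (P.trans ([m+kn]%n≡m%n r q m) (m<n⇒m%n≡m r<m))

    quot-of : ∀ q r → r < m → (q *ₙ m +ₙ r) / m ≡ q
    quot-of q r r<m = N.*-cancelʳ-≡ _ q m (N.+-cancelʳ-≡ r _ _ (P.sym (P.trans eq (P.cong ((q *ₙ m +ₙ r) / m *ₙ m +ₙ_) (rem-of q r r<m)))))
      where eq : q *ₙ m +ₙ r ≡ (q *ₙ m +ₙ r) / m *ₙ m +ₙ (q *ₙ m +ₙ r) % m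
            eq = divmod (q *ₙ m +ₙ r)

    A : Matrix
    A i s = δ (s % m) (complement (i % m))
          * (pow R b (i / m) * walks (i / m *ₙ 2 +ₙ carry (i % m)) 0 (s / m *ₙ 2 +ₙ carry (i % m)))

    W : Matrix
    W s j = δ (s % m) (j % m)
          * (pow R b (j / m +ₙ carry (j % m)) * walks (j / m *ₙ 2 +ₙ carry (j % m)) (s / m *ₙ 2 +ₙ carry (j % m)) 0)

    A-at : ∀ q' r' k ρ → r' < m → ρ < m → A (q' *ₙ m +ₙ r') (k *ₙ m +ₙ ρ)
         ≡ δ ρ (complement r') * (pow R b q' * walks (q' *ₙ 2 +ₙ carry r') 0 (k *ₙ 2 +ₙ carry r'))
    A-at q' r' k ρ r'<m ρ<m
      rewrite rem-of k ρ ρ<m | quot-of k ρ ρ<m | rem-of q' r' r'<m | quot-of q' r' r'<m = P.refl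

    W-at : ∀ k ρ q r → ρ < m → r < m → W (k *ₙ m +ₙ ρ) (q *ₙ m +ₙ r)
         ≡ δ ρ r * (pow R b (q +ₙ carry r) * walks (q *ₙ 2 +ₙ carry r) (k *ₙ 2 +ₙ carry r) 0)
    W-at k ρ q r ρ<m r<m
      rewrite rem-of k ρ ρ<m | quot-of k ρ ρ<m | rem-of q r r<m | quot-of q r r<m = P.refl

    -- W is upper triangular: for j < s with equal residues, the walk would
    -- have to descend 2(s/m - j/m) > 0 levels more than its length allows.
    W-upper : ∀ s j → j < s → W s j ≈ 0#
    W-upper s j j<s with s % m ≟ j % m
    ... | no _    = zeroˡ _
    ... | yes s≡j = trans (*-cong refl (*-cong refl (walks-out-of-reach-below _ _ 0 too-far)))
                      (trans (*-cong refl (zeroʳ _)) (zeroʳ _))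
      where
      quot< : j / m < s / m
      quot< = N.*-cancelʳ-< m (j / m) (s / m) (N.+-cancelʳ-< (j % m) _ _
                (P.subst₂ _<_ (divmod j) (P.trans (divmod s) (P.cong (s / m *ₙ m +ₙ_) s≡j)) j<s))
      too-far : j / m *ₙ 2 +ₙ carry (j % m) +ₙ 0 < s / m *ₙ 2 +ₙ carry (j % m)
      too-far = P.subst (_< s / m *ₙ 2 +ₙ carry (j % m)) (P.sym (N.+-identityʳ _))
                  (N.+-monoˡ-< (carry (j % m)) (N.*-monoˡ-< 2 quot<))

    carry-complement : ∀ r → r < m → carry (complement r) ≡ carry r
    carry-complement zero    _           = P.refl
    carry-complement (suc r) (s≤s r<m') with m' ∸ r | N.m<n⇒0<n∸m r<m'
    ... | suc _ | _ = P.refl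

    sum-off-multiple : ∀ q' r' q r → r' < m → r < m → r ≢ complement r' →
      Σ ℕ (λ T → Σ ℕ (λ ρ → (0 < ρ) × (ρ < m) × ((q' *ₙ m +ₙ r') +ₙ (q *ₙ m +ₙ r) ≡ T *ₙ m +ₙ ρ)))
    sum-off-multiple q' zero q r _ r<m r≢ = q' +ₙ q , r , N.n≢0⇒n>0 r≢ , r<m , regroup q' q r m'
      where regroup : ∀ a b c μ → (a *ₙ suc μ +ₙ 0) +ₙ (b *ₙ suc μ +ₙ c) ≡ (a +ₙ b) *ₙ suc μ +ₙ c
            regroup = solve-∀
    sum-off-multiple q' (suc r'') q r r'<m r<m r≢ with N.<-cmp (suc r'' +ₙ r) m
    ... | tri< lt _ _ = q' +ₙ q , suc r'' +ₙ r , s≤s z≤n , lt , regroup q' q (suc r'') r m'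
      where regroup : ∀ a b c e μ → (a *ₙ suc μ +ₙ c) +ₙ (b *ₙ suc μ +ₙ e) ≡ (a +ₙ b) *ₙ suc μ +ₙ (c +ₙ e)
            regroup = solve-∀
    ... | tri≈ _ e _ = ⊥-elim (r≢ (P.trans (P.sym (N.m+n∸m≡n (suc r'') r)) (P.cong (_∸ suc r'') e)))
    ... | tri> _ _ gt = q' +ₙ q +ₙ 1 , d , 0<d , d<m ,
          P.trans (regroup₁ q' q (suc r'') r m') (P.trans (P.cong ((q' *ₙ m +ₙ q *ₙ m) +ₙ_) (P.sym (N.m+[n∸m]≡n (N.<⇒≤ gt))))
                                                            (regroup₂ q' q d m'))
      where
      d : ℕ
      d = suc r'' +ₙ r ∸ m
      0<d : 0 < d
      0<d = P.subst (_< d) (N.n∸n≡0 m) (N.∸-monoˡ-< gt N.≤-refl)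
      d<m : d < m
      d<m = P.subst (d <_) (N.m+n∸m≡n m m) (N.∸-monoˡ-< (N.+-mono-< r'<m r<m) (N.<⇒≤ gt))
      regroup₁ : ∀ a b c e μ → (a *ₙ suc μ +ₙ c) +ₙ (b *ₙ suc μ +ₙ e) ≡ (a *ₙ suc μ +ₙ b *ₙ suc μ) +ₙ (c +ₙ e)
      regroup₁ = solve-∀
      regroup₂ : ∀ a b x μ → (a *ₙ suc μ +ₙ b *ₙ suc μ) +ₙ (suc μ +ₙ x) ≡ (a +ₙ b +ₙ 1) *ₙ suc μ +ₙ x
      regroup₂ = solve-∀

    sum-at-multiple : ∀ q' r' q → r' < m →
      (q' *ₙ m +ₙ r') +ₙ (q *ₙ m +ₙ complement r') ≡ (q' +ₙ (q +ₙ carry r')) *ₙ m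
    sum-at-multiple q' zero q _ = regroup q' q m'
      where regroup : ∀ a b μ → (a *ₙ suc μ +ₙ 0) +ₙ (b *ₙ suc μ +ₙ 0) ≡ (a +ₙ (b +ₙ 0)) *ₙ suc μ
            regroup = solve-∀
    sum-at-multiple q' (suc r'') q r'<m =
      P.trans (regroup₁ q' q (suc r'') (m ∸ suc r'') m')
        (P.trans (P.cong ((q' *ₙ m +ₙ q *ₙ m) +ₙ_) (N.m+[n∸m]≡n (N.<⇒≤ r'<m))) (regroup₂ q' q m'))
      where
      regroup₁ : ∀ a b c e μ → (a *ₙ suc μ +ₙ c) +ₙ (b *ₙ suc μ +ₙ e) ≡ (a *ₙ suc μ +ₙ b *ₙ suc μ) +ₙ (c +ₙ e)
      regroup₁ = solve-∀
      regroup₂ : ∀ a b μ → (a *ₙ suc μ +ₙ b *ₙ suc μ) +ₙ suc μ ≡ (a +ₙ (b +ₙ 1)) *ₙ suc μ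
      regroup₂ = solve-∀

    carry≤1 : ∀ r → carry r ≤ 1
    carry≤1 zero    = z≤n
    carry≤1 (suc r) = s≤s z≤n

    walks-wrong-parity : ∀ q' k p → p ≤ 1 → walks (q' *ₙ 2 +ₙ p) 0 (k *ₙ 2 +ₙ (1 ∸ p)) ≈ 0#
    walks-wrong-parity q' k zero _ = walks-parity (q' *ₙ 2 +ₙ 0) 0 (k *ₙ 2 +ₙ 1) (q' +ₙ k , odd q' k)
      where odd : ∀ a b → a *ₙ 2 +ₙ 0 +ₙ 0 +ₙ (b *ₙ 2 +ₙ 1) ≡ suc ((a +ₙ b) +ₙ (a +ₙ b))
            odd = solve-∀
    walks-wrong-parity q' k (suc zero) _ = walks-parity (q' *ₙ 2 +ₙ 1) 0 (k *ₙ 2 +ₙ 0) (q' +ₙ k , odd q' k)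
      where odd : ∀ a b → a *ₙ 2 +ₙ 1 +ₙ 0 +ₙ (b *ₙ 2 +ₙ 0) ≡ suc ((a +ₙ b) +ₙ (a +ₙ b))
            odd = solve-∀
    walks-wrong-parity q' k (suc (suc p)) (s≤s ())

    sumTo-one-parity : ∀ K p (φ : ℕ → Carrier) → p ≤ 1 → (∀ k → φ (k *ₙ 2 +ₙ (1 ∸ p)) ≈ 0#) →
                       sumTo (K *ₙ 2) φ ≈ sumTo K (λ k → φ (k *ₙ 2 +ₙ p))
    sumTo-one-parity K p φ p≤1 e = trans (sumTo-blocks 2 K φ) (sumTo-cong K (λ k _ → pair k p p≤1 (e k)))
      where
      pair : ∀ k p → p ≤ 1 → φ (k *ₙ 2 +ₙ (1 ∸ p)) ≈ 0# → φ (k *ₙ 2 +ₙ 0) + (φ (k *ₙ 2 +ₙ 1) + 0#) ≈ φ (k *ₙ 2 +ₙ p)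
      pair k zero          _        z = trans (+-cong refl (trans (+-identityʳ _) z)) (+-identityʳ _)
      pair k (suc zero)    _        z = trans (+-cong z (+-identityʳ _)) (+-identityˡ _)
      pair k (suc (suc p)) (s≤s ()) z

    AW-residue : ∀ i q r K → r < m →
      sumTo (K *ₙ m) (λ s → A i s * W s (q *ₙ m +ₙ r)) ≈ sumTo K (λ k → A i (k *ₙ m +ₙ r) * W (k *ₙ m +ₙ r) (q *ₙ m +ₙ r))
    AW-residue i q r K r<m = trans (sumTo-blocks m K _) (sumTo-cong K (λ k _ →
      sumTo-single m r (λ ρ → A i (k *ₙ m +ₙ ρ) * W (k *ₙ m +ₙ ρ) (q *ₙ m +ₙ r)) r<m
        (λ ρ ρ<m ρ≢r → trans (*-cong refl (trans (reflexive (W-at k ρ q r ρ<m r<m)) (trans (*-cong (δ-≢ ρ r ρ≢r) refl) (zeroˡ _))))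
                              (zeroʳ _))))

    AW-term-matching : ∀ q' r' q k → r' < m → complement r' < m →
      A (q' *ₙ m +ₙ r') (k *ₙ m +ₙ complement r') * W (k *ₙ m +ₙ complement r') (q *ₙ m +ₙ complement r')
        ≈ pow R b (q' +ₙ (q +ₙ carry r'))
          * (walks (q' *ₙ 2 +ₙ carry r') 0 (k *ₙ 2 +ₙ carry r') * walks (q *ₙ 2 +ₙ carry r') (k *ₙ 2 +ₙ carry r') 0)
    AW-term-matching q' r' q k r'<m r<m = begin
      A (q' *ₙ m +ₙ r') (k *ₙ m +ₙ r) * W (k *ₙ m +ₙ r) (q *ₙ m +ₙ r)
        ≡⟨ P.cong₂ _*_ (A-at q' r' k r r'<m r<m) (P.trans (W-at k r q r r<m r<m)
             (P.cong (λ z → δ r r * (pow R b (q +ₙ z) * walks (q *ₙ 2 +ₙ z) (k *ₙ 2 +ₙ z) 0)) (carry-complement r' r'<m))) ⟩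
      (δ r r * (pow R b q' * walks a 0 h)) * (δ r r * (pow R b (q +ₙ p) * walks e h 0))
        ≈⟨ *-cong (*-cong (δ-≡ r) refl) (*-cong (δ-≡ r) refl) ⟩
      (1# * (pow R b q' * walks a 0 h)) * (1# * (pow R b (q +ₙ p) * walks e h 0))
        ≈⟨ solve 4 (λ x y u v → (con 1 :* (x :* y)) :* (con 1 :* (u :* v)) := (x :* u) :* (y :* v)) refl _ _ _ _ ⟩
      (pow R b q' * pow R b (q +ₙ p)) * (walks a 0 h * walks e h 0)
        ≈⟨ *-cong (sym (pow-+ b q' (q +ₙ p))) refl ⟩
      pow R b (q' +ₙ (q +ₙ p)) * (walks a 0 h * walks e h 0) ∎
      where
      r : ℕ
      r = complement r'
      p : ℕ
      p = carry r'
      a : ℕ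
      a = q' *ₙ 2 +ₙ p
      e : ℕ
      e = q *ₙ 2 +ₙ p
      h : ℕ
      h = k *ₙ 2 +ₙ p

    -- When i + j is a multiple Tm, the entry of A·W splits the closed walks of
    -- length 2T counted by f(Tm) = C_T b^T at time 2(i/m) + carry.
    AW-entry-multiple : ∀ q' r' q K → r' < m → complement r' < m → q' < K →
      sumTo K (λ k → A (q' *ₙ m +ₙ r') (k *ₙ m +ₙ complement r') * W (k *ₙ m +ₙ complement r') (q *ₙ m +ₙ complement r'))
        ≈ f ((q' *ₙ m +ₙ r') +ₙ (q *ₙ m +ₙ complement r'))
    AW-entry-multiple q' r' q K r'<m r<m q'<K = begin
      sumTo K (λ k → A (q' *ₙ m +ₙ r') (k *ₙ m +ₙ r) * W (k *ₙ m +ₙ r) (q *ₙ m +ₙ r))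
                                                     ≈⟨ sumTo-cong K (λ k _ → AW-term-matching q' r' q k r'<m r<m) ⟩
      sumTo K (λ k → pow R b T * φ (k *ₙ 2 +ₙ p))    ≈⟨ sym (sumTo-*ˡ K (pow R b T) (λ k → φ (k *ₙ 2 +ₙ p))) ⟩
      pow R b T * sumTo K (λ k → φ (k *ₙ 2 +ₙ p))    ≈⟨ *-cong refl (sym (sumTo-one-parity K p φ (carry≤1 r')
                                                           (λ k → trans (*-cong (walks-wrong-parity q' k p (carry≤1 r')) refl) (zeroˡ _)))) ⟩
      pow R b T * sumTo (K *ₙ 2) φ                   ≈⟨ *-cong refl (sym (walks-split a e 0 0 (K *ₙ 2) within)) ⟩
      pow R b T * walks (a +ₙ e) 0 0                 ≡⟨ P.cong (λ z → pow R b T * dyck z) (regroup q' q p) ⟩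
      pow R b T * dyck (T *ₙ 2)                      ≈⟨ *-comm _ _ ⟩
      dyck (T *ₙ 2) * pow R b T                      ≈⟨ sym (coeff-multiple T) ⟩
      f (T *ₙ m)                                     ≡⟨ P.cong f (P.sym (sum-at-multiple q' r' q r'<m)) ⟩
      f ((q' *ₙ m +ₙ r') +ₙ (q *ₙ m +ₙ r))           ∎
      where
      r : ℕ
      r = complement r'
      p : ℕ
      p = carry r'
      T : ℕ
      T = q' +ₙ (q +ₙ p)
      a : ℕ
      a = q' *ₙ 2 +ₙ p
      e : ℕ
      e = q *ₙ 2 +ₙ p
      φ : ℕ → Carrier
      φ h = walks a 0 h * walks e h 0
      within : 0 +ₙ a < K *ₙ 2
      within = N.≤-trans (s≤s (N.+-monoʳ-≤ (q' *ₙ 2) (carry≤1 r')))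
                 (P.subst (_≤ K *ₙ 2) (next-even q') (N.*-monoˡ-≤ 2 q'<K))
        where next-even : ∀ x → suc x *ₙ 2 ≡ suc (x *ₙ 2 +ₙ 1)
              next-even = solve-∀
      regroup : ∀ x y z → (x *ₙ 2 +ₙ z) +ₙ (y *ₙ 2 +ₙ z) ≡ (x +ₙ (y +ₙ z)) *ₙ 2
      regroup = solve-∀

    AW-entry : ∀ q' r' q r K → r' < m → r < m → q' < K →
      sumTo (K *ₙ m) (λ s → A (q' *ₙ m +ₙ r') s * W s (q *ₙ m +ₙ r)) ≈ f ((q' *ₙ m +ₙ r') +ₙ (q *ₙ m +ₙ r))
    AW-entry q' r' q r K r'<m r<m q'<K =
      trans (AW-residue (q' *ₙ m +ₙ r') q r K r<m) (by-residue r r<m (r ≟ complement r'))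
      where
      by-residue : ∀ r → r < m → Dec (r ≡ complement r') →
        sumTo K (λ k → A (q' *ₙ m +ₙ r') (k *ₙ m +ₙ r) * W (k *ₙ m +ₙ r) (q *ₙ m +ₙ r)) ≈ f ((q' *ₙ m +ₙ r') +ₙ (q *ₙ m +ₙ r))
      by-residue r r<m (yes P.refl) = AW-entry-multiple q' r' q K r'<m r<m q'<K
      by-residue r r<m (no r≢) with sum-off-multiple q' r' q r r'<m r<m r≢
      ... | T , ρ , 0<ρ , ρ<m , i+j≡ =
        trans (sumTo-zero K (λ k _ → trans (*-cong (trans (reflexive (A-at q' r' k r r'<m r<m))
                                                         (trans (*-cong (δ-≢ r (complement r') r≢) refl) (zeroˡ _))) refl)
                                             (zeroˡ _)))
              (sym (trans (reflexive (P.cong f i+j≡)) (coeff-off T ρ 0<ρ ρ<m)))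

    hankel : Matrix
    hankel i j = f (i +ₙ j)

    hankel≈AW : ∀ N i j → i < N → j < N → hankel i j ≈ sumTo N (λ s → A i s * W s j)
    hankel≈AW N i j i<N j<N = sym (begin
      sumTo N (λ s → A i s * W s j)            ≈⟨ sumTo-extend N (N *ₙ m) _ N≤Nm
                                                    (λ s N≤s _ → trans (*-cong refl (W-upper s j (N.<-≤-trans j<N N≤s))) (zeroʳ _)) ⟩
      sumTo (N *ₙ m) (λ s → A i s * W s j)     ≡⟨ P.cong₂ (λ x y → sumTo (N *ₙ m) (λ s → A x s * W s y)) (divmod i) (divmod j) ⟩
      sumTo (N *ₙ m) (λ s → A (i / m *ₙ m +ₙ i % m) s * W s (j / m *ₙ m +ₙ j % m))
                                               ≈⟨ AW-entry (i / m) (i % m) (j / m) (j % m) N (m%n<n i m) (m%n<n j m)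
                                                    (N.≤-<-trans (m/n≤m i m) i<N) ⟩
      f ((i / m *ₙ m +ₙ i % m) +ₙ (j / m *ₙ m +ₙ j % m))
                                               ≡⟨ P.cong f (P.sym (P.cong₂ _+ₙ_ (divmod i) (divmod j))) ⟩
      hankel i j                               ∎)
      where
      N≤Nm : N ≤ N *ₙ m
      N≤Nm = P.subst (_≤ N *ₙ m) (N.*-identityʳ N) (N.*-monoʳ-≤ N (s≤s z≤n))

    det-hankel≈det-A : ∀ N → detℕ N hankel ≈ detℕ N A * prodTo N (λ j → W j j)
    det-hankel≈det-A N = det-mul-upper N A W hankel (λ s j j<s _ → W-upper s j j<s) (hankel≈AW N)

    -- Block structure of A: within a block of m consecutive indices, row 0 is
    -- supported on the diagonal and row r > 0 on the anti-diagonal entry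
    -- m - r; entries to the right of the diagonal block vanish.
    block : ℕ → Matrix
    block q i k = A (q *ₙ m +ₙ i) (q *ₙ m +ₙ k)

    A-within-block : ∀ q i c → i < m → c ≢ complement i → block q i c ≈ 0#
    A-within-block q i c i<m c≢ rewrite rem-of q i i<m | quot-of q i i<m = by-residue (s % m ≟ complement i)
      where
      s : ℕ
      s = q *ₙ m +ₙ c
      q≤s/m : q ≤ s / m
      q≤s/m = P.subst (_≤ s / m) (m*n/n≡m q m) (/-monoˡ-≤ m (N.m≤m+n (q *ₙ m) c))
      remainder : s / m ≡ q → c ≡ s % m
      remainder e = N.+-cancelˡ-≡ (q *ₙ m) _ _ (P.trans (divmod s) (P.cong (λ z → z *ₙ m +ₙ s % m) e))
      by-residue : Dec (s % m ≡ complement i) →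
        δ (s % m) (complement i) * (pow R b q * walks (q *ₙ 2 +ₙ carry i) 0 (s / m *ₙ 2 +ₙ carry i)) ≈ 0#
      by-residue (no ne)  = trans (*-cong (δ-≢ _ _ ne) refl) (zeroˡ _)
      by-residue (yes eq) = trans (*-cong refl (trans (*-cong refl (walks-out-of-reach-above _ 0 _ too-far)) (zeroʳ _))) (zeroʳ _)
        where
        q<s/m : q < s / m
        q<s/m = N.≤∧≢⇒< q≤s/m (λ q≡ → c≢ (P.trans (remainder (P.sym q≡)) eq))
        too-far : q *ₙ 2 +ₙ carry i +ₙ 0 < s / m *ₙ 2 +ₙ carry i
        too-far = P.subst (_< s / m *ₙ 2 +ₙ carry i) (P.sym (N.+-identityʳ _)) (N.+-monoˡ-< (carry i) (N.*-monoˡ-< 2 q<s/m))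

    block-corner : ∀ q → block q 0 0 ≈ pow R b q
    block-corner q = trans (reflexive (A-at q 0 q 0 (s≤s z≤n) (s≤s z≤n)))
      (trans (*-identityˡ _) (trans (*-cong refl (walks-straight-up (q *ₙ 2 +ₙ 0) 0)) (*-identityʳ _)))

    block-antidiagonal : ∀ q t → t < m' → block q (suc t) (suc (m' ∸ suc t)) ≈ pow R b q
    block-antidiagonal q t t<m' =
      trans (reflexive (A-at q (suc t) q (suc (m' ∸ suc t)) (s≤s t<m') (s≤s (N.∸-monoʳ-< (s≤s z≤n) t<m'))))
        (trans (*-cong (trans (reflexive (P.cong (λ z → δ z (m' ∸ t)) (P.sym (N.+-∸-assoc 1 t<m')))) (δ-≡ (m' ∸ t)))
                       (*-cong refl (walks-straight-up (q *ₙ 2 +ₙ 1) 0)))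
          (trans (*-identityˡ _) (*-identityʳ _)))

    block-next : ∀ q i k → block q (suc (m' +ₙ i)) (suc (m' +ₙ k)) ≡ block (suc q) i k
    block-next q i k = P.cong₂ A (shifted q i m') (shifted q k m')
      where shifted : ∀ q i μ → q *ₙ suc μ +ₙ suc (μ +ₙ i) ≡ suc q *ₙ suc μ +ₙ i
            shifted = solve-∀

    blockDet : ℕ → Carrier
    blockDet u = pow R b u * (sgn R (m' C 2) * prodTo m' (λ _ → pow R b u))

    det-A-blocks : ∀ t q e → detℕ (t *ₙ m +ₙ e) (block q) ≈ prodTo t (λ u → blockDet (q +ₙ u)) * detℕ e (block (q +ₙ t))
    det-A-blocks zero    q e = sym (trans (*-identityˡ _) (reflexive (P.cong (λ z → detℕ e (block z)) (N.+-identityʳ q))))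
    det-A-blocks (suc t) q e = begin
      detℕ (suc t *ₙ m +ₙ e) (block q)
        ≡⟨ P.cong (λ z → detℕ z (block q)) (P.cong suc (N.+-assoc m' (t *ₙ m) e)) ⟩
      detℕ (suc (m' +ₙ (t *ₙ m +ₙ e))) (block q)
        ≈⟨ det-first-row (m' +ₙ (t *ₙ m +ₙ e)) (block q) (λ c 0<c _ → A-within-block q 0 c (s≤s z≤n) (N.>⇒≢ 0<c)) ⟩
      block q 0 0 * detℕ (m' +ₙ (t *ₙ m +ₙ e)) (λ i k → block q (suc i) (suc k))
        ≈⟨ *-cong refl (det-antidiagonal m' (t *ₙ m +ₙ e) _ (λ t' k t'<m' _ k≢ →
             A-within-block q (suc t') (suc k) (s≤s t'<m')
               (λ q≡ → k≢ (P.trans (P.cong pred q≡) (N.pred[m∸n]≡m∸[1+n] m' t'))))) ⟩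
      block q 0 0 * ((sgn R (m' C 2) * prodTo m' (λ t' → block q (suc t') (suc (m' ∸ suc t'))))
                     * detℕ (t *ₙ m +ₙ e) (λ i k → block q (suc (m' +ₙ i)) (suc (m' +ₙ k))))
        ≈⟨ *-cong (block-corner q) (*-cong (*-cong refl (prodTo-cong m' (λ t' t'<m' → block-antidiagonal q t' t'<m')))
             (detℕ-cong (t *ₙ m +ₙ e) (λ i k _ _ → reflexive (block-next q i k)))) ⟩
      pow R b q * ((sgn R (m' C 2) * prodTo m' (λ _ → pow R b q)) * detℕ (t *ₙ m +ₙ e) (block (suc q)))
        ≈⟨ *-cong refl (*-cong refl (det-A-blocks t (suc q) e)) ⟩
      pow R b q * ((sgn R (m' C 2) * prodTo m' (λ _ → pow R b q))
                   * (prodTo t (λ u → blockDet (suc q +ₙ u)) * detℕ e (block (suc q +ₙ t))))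
        ≈⟨ solve 4 (λ x s y d → x :* (s :* (y :* d)) := ((x :* s) :* y) :* d) refl _ _ _ _ ⟩
      (blockDet q * prodTo t (λ u → blockDet (suc q +ₙ u))) * detℕ e (block (suc q +ₙ t))
        ≈⟨ *-cong (*-cong (reflexive (P.cong blockDet (P.sym (N.+-identityʳ q))))
                          (prodTo-cong t (λ u _ → reflexive (P.cong blockDet (P.sym (N.+-suc q u))))))
                  (reflexive (P.cong (λ z → detℕ e (block z)) (P.sym (N.+-suc q t)))) ⟩
      prodTo (suc t) (λ u → blockDet (q +ₙ u)) * detℕ e (block (q +ₙ suc t)) ∎

    W-diagonal : ∀ u r → r < m → W (u *ₙ m +ₙ r) (u *ₙ m +ₙ r) ≈ pow R b (u +ₙ carry r)
    W-diagonal u r r<m = trans (reflexive (W-at u r u r r<m r<m))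
      (trans (*-cong (δ-≡ r) (*-cong refl (walks-straight-down (u *ₙ 2 +ₙ carry r)))) (trans (*-identityˡ _) (*-identityʳ _)))

    -- The power of b contributed by block u of A together with the matching
    -- m diagonal entries of W.
    blockExponent : ℕ → ℕ
    blockExponent u = (u +ₙ u *ₙ m') +ₙ (u +ₙ (u +ₙ 1) *ₙ m')

    full-block : ∀ u → blockDet u * prodTo m (λ r → W (u *ₙ m +ₙ r) (u *ₙ m +ₙ r)) ≈ sgn R (m' C 2) * pow R b (blockExponent u)
    full-block u = begin
      blockDet u * prodTo m (λ r → W (u *ₙ m +ₙ r) (u *ₙ m +ₙ r))
        ≈⟨ *-cong (*-cong refl (*-cong refl (prodTo-const m' (pow R b u)))) (prodTo-cong m (λ r r<m → W-diagonal u r r<m)) ⟩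
      (pow R b u * (sgn R (m' C 2) * pow R (pow R b u) m')) * (pow R b (u +ₙ 0) * prodTo m' (λ _ → pow R b (u +ₙ 1)))
        ≈⟨ *-cong refl (*-cong (reflexive (P.cong (pow R b) (N.+-identityʳ u))) (prodTo-const m' (pow R b (u +ₙ 1)))) ⟩
      (pow R b u * (sgn R (m' C 2) * pow R (pow R b u) m')) * (pow R b u * pow R (pow R b (u +ₙ 1)) m')
        ≈⟨ *-cong (*-cong refl (*-cong refl (sym (pow-* b u m')))) (*-cong refl (sym (pow-* b (u +ₙ 1) m'))) ⟩
      (pow R b u * (sgn R (m' C 2) * pow R b (u *ₙ m'))) * (pow R b u * pow R b ((u +ₙ 1) *ₙ m'))
        ≈⟨ solve 5 (λ x s y z w → (x :* (s :* y)) :* (z :* w) := s :* ((x :* y) :* (z :* w))) refl _ _ _ _ _ ⟩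
      sgn R (m' C 2) * ((pow R b u * pow R b (u *ₙ m')) * (pow R b u * pow R b ((u +ₙ 1) *ₙ m')))
        ≈⟨ *-cong refl (trans (*-cong (sym (pow-+ b u (u *ₙ m'))) (sym (pow-+ b u ((u +ₙ 1) *ₙ m'))))
                              (sym (pow-+ b (u +ₙ u *ₙ m') (u +ₙ (u +ₙ 1) *ₙ m')))) ⟩
      sgn R (m' C 2) * pow R b (blockExponent u) ∎

    exponent-step : ∀ t → t *ₙ (m *ₙ t ∸ 1) +ₙ blockExponent t ≡ suc t *ₙ (m *ₙ suc t ∸ 1)
    exponent-step zero    = regroup m'
      where regroup : ∀ μ → (0 +ₙ 0 *ₙ μ) +ₙ (0 +ₙ (0 +ₙ 1) *ₙ μ) ≡ 1 *ₙ (μ *ₙ 1)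
            regroup = solve-∀
    exponent-step (suc t) = regroup t m'
      where regroup : ∀ t μ → suc t *ₙ (t +ₙ μ *ₙ suc t) +ₙ ((suc t +ₙ suc t *ₙ μ) +ₙ (suc t +ₙ (suc t +ₙ 1) *ₙ μ))
                               ≡ suc (suc t) *ₙ (suc t +ₙ μ *ₙ suc (suc t))
            regroup = solve-∀

    full-blocks : ∀ t → prodTo t (λ u → sgn R (m' C 2) * pow R b (blockExponent u))
                        ≈ sgn R ((m' C 2) *ₙ t) * pow R b (t *ₙ (m *ₙ t ∸ 1))
    full-blocks zero    = trans (sym (*-identityʳ 1#)) (*-cong (reflexive (P.cong (sgn R) (P.sym (N.*-zeroʳ (m' C 2))))) refl)
    full-blocks (suc t) = begin
      prodTo (suc t) (λ u → sgn R (m' C 2) * pow R b (blockExponent u))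
        ≈⟨ prodTo-last t _ ⟩
      prodTo t (λ u → sgn R (m' C 2) * pow R b (blockExponent u)) * (sgn R (m' C 2) * pow R b (blockExponent t))
        ≈⟨ *-cong (full-blocks t) refl ⟩
      (sgn R ((m' C 2) *ₙ t) * pow R b (t *ₙ (m *ₙ t ∸ 1))) * (sgn R (m' C 2) * pow R b (blockExponent t))
        ≈⟨ solve 4 (λ a x s y → (a :* x) :* (s :* y) := (a :* s) :* (x :* y)) refl _ _ _ _ ⟩
      (sgn R ((m' C 2) *ₙ t) * sgn R (m' C 2)) * (pow R b (t *ₙ (m *ₙ t ∸ 1)) * pow R b (blockExponent t))
        ≈⟨ *-cong (sym (sgn-+ ((m' C 2) *ₙ t) (m' C 2))) (sym (pow-+ b (t *ₙ (m *ₙ t ∸ 1)) (blockExponent t))) ⟩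
      sgn R ((m' C 2) *ₙ t +ₙ m' C 2) * pow R b (t *ₙ (m *ₙ t ∸ 1) +ₙ blockExponent t)
        ≡⟨ P.cong₂ (λ x y → sgn R x * pow R b y)
             (P.trans (N.+-comm ((m' C 2) *ₙ t) (m' C 2)) (P.sym (N.*-suc (m' C 2) t))) (exponent-step t) ⟩
      sgn R ((m' C 2) *ₙ suc t) * pow R b (suc t *ₙ (m *ₙ suc t ∸ 1)) ∎

    det-hankel-blocks : ∀ t e → detℕ (t *ₙ m +ₙ e) hankel
      ≈ (sgn R ((m' C 2) *ₙ t) * pow R b (t *ₙ (m *ₙ t ∸ 1))) * (detℕ e (block t) * prodTo e (λ k → W (t *ₙ m +ₙ k) (t *ₙ m +ₙ k)))
    det-hankel-blocks t e = begin
      detℕ (t *ₙ m +ₙ e) hankel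
        ≈⟨ det-hankel≈det-A (t *ₙ m +ₙ e) ⟩
      detℕ (t *ₙ m +ₙ e) A * prodTo (t *ₙ m +ₙ e) Wd
        ≈⟨ *-cong (det-A-blocks t 0 e) (trans (prodTo-split (t *ₙ m) e Wd) (*-cong (prodTo-blocks m t Wd) refl)) ⟩
      (prodTo t blockDet * detℕ e (block t)) * (prodTo t (λ u → prodTo m (λ r → Wd (u *ₙ m +ₙ r))) * prodTo e (λ k → Wd (t *ₙ m +ₙ k)))
        ≈⟨ solve 4 (λ p d q w → (p :* d) :* (q :* w) := (p :* q) :* (d :* w)) refl _ _ _ _ ⟩
      (prodTo t blockDet * prodTo t (λ u → prodTo m (λ r → Wd (u *ₙ m +ₙ r)))) * (detℕ e (block t) * prodTo e (λ k → Wd (t *ₙ m +ₙ k)))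
        ≈⟨ *-cong (trans (sym (prodTo-* t blockDet _)) (prodTo-cong t (λ u _ → full-block u))) refl ⟩
      prodTo t (λ u → sgn R (m' C 2) * pow R b (blockExponent u)) * (detℕ e (block t) * prodTo e (λ k → Wd (t *ₙ m +ₙ k)))
        ≈⟨ *-cong (full-blocks t) refl ⟩
      (sgn R ((m' C 2) *ₙ t) * pow R b (t *ₙ (m *ₙ t ∸ 1))) * (detℕ e (block t) * prodTo e (λ k → Wd (t *ₙ m +ₙ k))) ∎
      where
      Wd : ℕ → Carrier
      Wd j = W j j

    det-hankel-multiple : ∀ t → detℕ (t *ₙ m) hankel ≈ sgn R ((m' C 2) *ₙ t) * pow R b (t *ₙ (m *ₙ t ∸ 1))
    det-hankel-multiple t = begin
      detℕ (t *ₙ m) hankel                     ≡⟨ P.cong (λ z → detℕ z hankel) (P.sym (N.+-identityʳ (t *ₙ m))) ⟩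
      detℕ (t *ₙ m +ₙ 0) hankel                ≈⟨ det-hankel-blocks t 0 ⟩
      (sgn R ((m' C 2) *ₙ t) * pow R b (t *ₙ (m *ₙ t ∸ 1))) * (1# * 1#)
                                               ≈⟨ trans (*-cong refl (*-identityʳ 1#)) (*-identityʳ _) ⟩
      sgn R ((m' C 2) *ₙ t) * pow R b (t *ₙ (m *ₙ t ∸ 1)) ∎

    det-hankel-multiple+1 : ∀ t → detℕ (t *ₙ m +ₙ 1) hankel ≈ sgn R ((m' C 2) *ₙ t) * pow R b (t *ₙ (m *ₙ t +ₙ 1))
    det-hankel-multiple+1 t = begin
      detℕ (t *ₙ m +ₙ 1) hankel
        ≈⟨ det-hankel-blocks t 1 ⟩
      (sgn R ((m' C 2) *ₙ t) * pow R b (t *ₙ (m *ₙ t ∸ 1))) * (detℕ 1 (block t) * (W (t *ₙ m +ₙ 0) (t *ₙ m +ₙ 0) * 1#))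
        ≈⟨ *-cong refl (*-cong corner (trans (*-identityʳ _) (W-diagonal t 0 (s≤s z≤n)))) ⟩
      (sgn R ((m' C 2) *ₙ t) * pow R b (t *ₙ (m *ₙ t ∸ 1))) * (pow R b t * pow R b (t +ₙ 0))
        ≈⟨ trans (*-assoc _ _ _) (*-cong refl (trans (*-cong refl (sym (pow-+ b t (t +ₙ 0)))) (sym (pow-+ b (t *ₙ (m *ₙ t ∸ 1)) (t +ₙ (t +ₙ 0)))))) ⟩
      sgn R ((m' C 2) *ₙ t) * pow R b (t *ₙ (m *ₙ t ∸ 1) +ₙ (t +ₙ (t +ₙ 0)))
        ≡⟨ P.cong (λ z → sgn R ((m' C 2) *ₙ t) * pow R b z) (exponent t) ⟩
      sgn R ((m' C 2) *ₙ t) * pow R b (t *ₙ (m *ₙ t +ₙ 1)) ∎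
      where
      corner : detℕ 1 (block t) ≈ pow R b t
      corner = trans (det-first-row 0 (block t) (λ { p 0<p (s≤s p≤0) → ⊥-elim (N.<⇒≱ 0<p p≤0) }))
                     (trans (*-identityʳ _) (block-corner t))
      exponent : ∀ t → t *ₙ (m *ₙ t ∸ 1) +ₙ (t +ₙ (t +ₙ 0)) ≡ t *ₙ (m *ₙ t +ₙ 1)
      exponent zero    = P.refl
      exponent (suc t) = regroup t m'
        where regroup : ∀ t μ → suc t *ₙ (t +ₙ μ *ₙ suc t) +ₙ (suc t +ₙ (suc t +ₙ 0)) ≡ suc t *ₙ (suc (t +ₙ μ *ₙ suc t) +ₙ 1)
              regroup = solve-∀

    -- For 2 ≤ e < m, row 1 of the leading e×e part of a block is supported
    -- on column m - 1 ≥ e, hence zero.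
    det-hankel-other : ∀ t e → 2 ≤ e → e < m → detℕ (t *ₙ m +ₙ e) hankel ≈ 0#
    det-hankel-other t (suc zero)     (s≤s ()) _
    det-hankel-other t (suc (suc e')) _        e<m = begin
      detℕ (t *ₙ m +ₙ suc (suc e')) hankel
        ≈⟨ det-hankel-blocks t (suc (suc e')) ⟩
      _ * (detℕ (suc (suc e')) (block t) * _)
        ≈⟨ *-cong refl (*-cong partial-block refl) ⟩
      _ * (0# * _)
        ≈⟨ trans (*-cong refl (zeroˡ _)) (zeroʳ _) ⟩
      0# ∎
      where
      e<m' : suc (suc e') ≤ m'
      e<m' = N.≤-pred e<m
      partial-block : detℕ (suc (suc e')) (block t) ≈ 0#
      partial-block =
        trans (det-first-row (suc e') (block t) (λ p 0<p _ → A-within-block t 0 p (s≤s z≤n) (N.>⇒≢ 0<p)))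
          (trans (*-cong refl (det-zero-first-row e' (λ i k → block t (suc i) (suc k)) (λ k k<e → A-within-block t 1 (suc k) (s≤s (N.<-≤-trans (s≤s z≤n) e<m'))
                                 (N.<⇒≢ (N.<-≤-trans (s≤s k<e) e<m')))))
            (zeroʳ _))

open import Data.Nat using (ℕ; _*_; _+_; _∸_; _≥_)
open import Data.Nat.Combinatorics using (_C_)
open import Data.Product using (_×_)
open import Relation.Binary.PropositionalEquality using (_≢_)

open import Data.Nat using (zero; suc; z≤n; s≤s; _≤_; _%_; _/_)
open import Data.Nat.DivMod using (m%n<n)
open import Data.Nat.Properties using (*-comm; +-identityʳ)
open import Data.Product using (_,_; proj₁; proj₂)
open import Data.Empty using (⊥-elim)
open import Relation.Binary.PropositionalEquality using (_≡_; refl; cong; trans)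

theorem5p4 : {c ℓ : Level} (R : CommutativeRing c ℓ) (m : ℕ) → m ≥ 1 →
    (b : CommutativeRing.Carrier R) (f : PowerSeries R) → IsFm R m b f →
    ((n : ℕ) → CommutativeRing._≈_ R (hankelDet R f (m * n))
        (CommutativeRing._*_ R (sgn R (((m ∸ 1) C 2) * n)) (pow R b (n * (m * n ∸ 1)))))
    × ((n : ℕ) → CommutativeRing._≈_ R (hankelDet R f (m * n + 1))
        (CommutativeRing._*_ R (sgn R (((m ∸ 1) C 2) * n)) (pow R b (n * (m * n + 1)))))
    × ((N : ℕ) → ((n : ℕ) → (N ≢ m * n) × (N ≢ m * n + 1)) →
        CommutativeRing._≈_ R (hankelDet R f N) (CommutativeRing.0# R))
theorem5p4 R (suc m') (s≤s z≤n) b f isF =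
    (λ n → R.trans (R.reflexive (cong (hankelDet R f) (*-comm m n))) (det-hankel-multiple n))
  , (λ n → R.trans (R.reflexive (cong (λ k → hankelDet R f (k + 1)) (*-comm m n))) (det-hankel-multiple+1 n))
  , λ N special → R.trans (R.reflexive (cong (hankelDet R f) (divmod N)))
                          (det-hankel-other (N / m) (N % m) (residue≥2 N special) (m%n<n N m))
  where
  module R = CommutativeRing R
  m : ℕ
  m = suc m'
  open Hankel R m' b f isF using (divmod; det-hankel-multiple; det-hankel-multiple+1; det-hankel-other)

  residue≥2 : ∀ N → ((n : ℕ) → (N ≢ m * n) × (N ≢ m * n + 1)) → 2 ≤ N % m
  residue≥2 N special = by-residue (N % m) refl
    where
    as-multiple : ∀ r → N % m ≡ r → N ≡ m * (N / m) + r
    as-multiple r eq = trans (divmod N) (trans (cong (λ k → k + N % m) (*-comm (N / m) m)) (cong (m * (N / m) +_) eq))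
    by-residue : ∀ r → N % m ≡ r → 2 ≤ r
    by-residue zero             eq = ⊥-elim (proj₁ (special (N / m)) (trans (as-multiple 0 eq) (+-identityʳ _)))
    by-residue (suc zero)       eq = ⊥-elim (proj₂ (special (N / m)) (as-multiple 1 eq))
    by-residue (suc (suc r))    _  = s≤s (s≤s z≤n)
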